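{- For every walk length $\tau$, the following three distributions over pairs $(\mathbf{x},\mathbf{y})\in[n]^d\times[n]^d$ are identical: (1) $\mathbf{x}$ uniform in $[n]^d$, $\mathbf{y}\sim\mathcal{U}_\tau(\mathbf{x})$; (2) $\boldsymbol{H}\sim\mathbb{H}$, $\mathbf{x}$ uniform in $\boldsymbol{H}$, $\mathbf{y}\sim\mathcal{U}_{\boldsymbol{H},\tau}(\mathbf{x})$; (3) $\mathbf{x}$ uniform in $[n]^d$, $\boldsymbol{H}\sim\mathbb{H}(\mathbf{x})$, $\mathbf{y}\sim\mathcal{U}_{\boldsymbol{H},\tau}(\mathbf{x})$. The analogous three distributions defined with the downward walks $\mathcal{D}_\tau$ and $\mathcal{D}_{\boldsymbol{H},\tau}$ are also identical.
   Context: $n$ is a power of $2$, $\log$ is base $2$. Intervals in $\mathbb{Z}_n$ wrap around: for $1\le i\le n<j$, $[i,j]=[i,n]\cup[1,(j-1)\bmod n]$. $\mathcal{U}_\tau(\mathbf{x})$: pick a uniform random $R\subseteq[d]$ of size $\tau$; for $r\in R$ pick $q_r$ uniform in $\{1,\dots,\log n\}$, a uniform random interval $I_r$ of $\mathbb{Z}_n$ of size $2^{q_r}$ containing $\mathbf{x}_r$, $c_r$ uniform in $I_r\setminus\{\mathbf{x}_r\}$; $\mathbf{y}_r=c_r$ if $r\in R$ and $c_r>\mathbf{x}_r$, else $\mathbf{y}_r=\mathbf{x}_r$. $\mathcal{D}_\tau(\mathbf{x})$: same with $c_r<\mathbf{x}_r$. Hypercube distribution $\mathbb{H}$: for each $i$,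 $q_i$ uniform in $\{1,\dots,\log n\}$, $I_i$ a uniform random interval of $\mathbb{Z}_n$ of size $2^{q_i}$, $(a_i,b_i)$ a uniform random pair from $I_i$ with $a_i<b_i$; output $\boldsymbol{H}=\prod_i\{a_i,b_i\}$. Conditioned distribution $\mathbb{H}(\mathbf{x})$: for each $i$, $q_i$ uniform in $\{1,\dots,\log n\}$, a uniform random interval $I_i$ of size $2^{q_i}$ containing $\mathbf{x}_i$, $c_i$ uniform in $I_i\setminus\{\mathbf{x}_i\}$, $a_i=\min(\mathbf{x}_i,c_i)$, $b_i=\max(\mathbf{x}_i,c_i)$. Hypercube walks: $\mathcal{U}_{\boldsymbol{H},\tau}(\mathbf{x})$ picks a uniform random $R\subseteq[d]$, $|R|=\tau$, and sets $\mathbf{y}_r=b_r$ if $r\in R$ and $\mathbf{x}_r=a_r$, else $\mathbf{y}_r=\mathbf{x}_r$; $\mathcal{D}_{\boldsymbol{H},\tau}(\mathbf{x})$ sets $\mathbf{y}_r=a_r$ if $r\in R$ and $\mathbf{x}_r=b_r$, else $\mathbf{y}_r=\mathbf{x}_r$. -}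

module Defs where

open import Data.Nat using (ℕ; zero; suc; _^_; _≤_; NonZero)
open import Data.Nat.Properties using (m^n≢0)
open import Data.Nat.DivMod using (_mod_)
open import Data.Bool using (Bool; true; false; if_then_else_; _∧_)
open import Data.Fin using (Fin; toℕ) renaming (_≟_ to _≟ᶠ_)
open import Data.Fin.Subset using (Subset; inside; outside; ∣_∣)
open import Data.List using (List; []; _∷_; map; concatMap; foldr; length; filter; allFin; upTo; _++_)
open import Data.Vec using (Vec; []; _∷_; lookup)
open import Data.Vec.Properties using (≡-dec)
open import Data.Product using (_×_; _,_; proj₁; proj₂)
open import Data.Product.Properties using () renaming (≡-dec to ×-≡-dec)
open import Data.Integer using (+_)
open import Data.Rational using (ℚ; _/_; _*_; _+_; 0ℚ; 1ℚ)
open import Relation.Nullary using (yes; no; ¬_)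
open import Relation.Nullary.Decidable using (⌊_⌋; ¬?)
open import Relation.Binary.PropositionalEquality using (_≡_)
import Data.Nat as ℕ

Dist : Set → Set
Dist A = List (ℚ × A)

return : {A : Set} → A → Dist A
return a = (1ℚ , a) ∷ []

_>>=_ : {A B : Set} → Dist A → (A → Dist B) → Dist B
D >>= f = concatMap (λ { (w , a) → map (λ { (v , b) → (w * v , b) }) (f a) }) D

-- uniform distribution over the entries of a list (all entries will be distinct)
uniform : {A : Set} → List A → Dist A
uniform [] = []
uniform (x ∷ xs) = map (λ a → ((+ 1) / suc (length xs) , a)) (x ∷ xs)

indep : {A : Set} (d : ℕ) → (Fin d → Dist A) → Dist (Vec A d)
indep zero f = return []
indep (suc d) f =
  f Fin.zero >>= λ a → indep d (λ i → f (Fin.suc i)) >>= λ as → return (a ∷ as)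
  where import Data.Fin as Fin

Pr : {A : Set} → (∀ (a b : A) → Relation.Nullary.Dec (a ≡ b)) → Dist A → A → ℚ
Pr _≟_ D o = foldr (λ { (w , a) acc → if ⌊ a ≟ o ⌋ then w + acc else acc }) 0ℚ D
  where import Relation.Nullary

-- The grid [n]^d with n = 2^k (so log n = k); [n] is represented by Fin n
-- (element j of [n] corresponds to toℕ j + 1).

N : ℕ → ℕ
N k = 2 ^ k

nzN : (k : ℕ) → NonZero (2 ^ k)
nzN k = m^n≢0 2 k

Pt : ℕ → Set
Pt k = Fin (N k)

Point : ℕ → ℕ → Set
Point k d = Vec (Pt k) d

_<ᵇ_ : {m : ℕ} → Fin m → Fin m → Bool
a <ᵇ b = toℕ a ℕ.<ᵇ toℕ b

interval : (k : ℕ) → Pt k → ℕ → List (Pt k)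
interval k start s = map (λ j → _mod_ (toℕ start ℕ.+ j) (N k) {{nzN k}}) (upTo s)

_∈ᵇ_ : {m : ℕ} → Fin m → List (Fin m) → Bool
x ∈ᵇ [] = false
x ∈ᵇ (y ∷ ys) = if ⌊ x ≟ᶠ y ⌋ then true else x ∈ᵇ ys

scales : ℕ → List ℕ
scales k = map suc (upTo k)

randInterval : (k q : ℕ) → Dist (List (Pt k))
randInterval k q = uniform (allFin (N k)) >>= λ st → return (interval k st (2 ^ q))

randIntervalContaining : (k q : ℕ) → Pt k → Dist (List (Pt k))
randIntervalContaining k q x =
  uniform (filter (λ st → x ∈ᵇ interval k st (2 ^ q) ≟ᵇ true) (allFin (N k)))
    >>= λ st → return (interval k st (2 ^ q))
  where open import Data.Bool using () renaming (_≟_ to _≟ᵇ_)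

randPartner : (k : ℕ) → Pt k → Dist (Pt k)
randPartner k x =
  uniform (scales k) >>= λ q →
  randIntervalContaining k q x >>= λ I →
  uniform (filter (λ c → ¬? (c ≟ᶠ x)) I)

allSubsets : (d : ℕ) → List (Subset d)
allSubsets zero = [] ∷ []
allSubsets (suc d) = map (inside ∷_) (allSubsets d) ++ map (outside ∷_) (allSubsets d)

subsetsOfSize : (d τ : ℕ) → List (Subset d)
subsetsOfSize d τ = filter (λ R → ∣ R ∣ ℕ.≟ τ) (allSubsets d)

upWalk : (k d τ : ℕ) → Point k d → Dist (Point k d)
upWalk k d τ x =
  uniform (subsetsOfSize d τ) >>= λ R →
  indep d (λ r → if lookup R r
                   then (randPartner k (lookup x r) >>= λ c →
                         return (if lookup x r <ᵇ c then c else lookup x r))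
                   else return (lookup x r))

downWalk : (k d τ : ℕ) → Point k d → Dist (Point k d)
downWalk k d τ x =
  uniform (subsetsOfSize d τ) >>= λ R →
  indep d (λ r → if lookup R r
                   then (randPartner k (lookup x r) >>= λ c →
                         return (if c <ᵇ lookup x r then c else lookup x r))
                   else return (lookup x r))

uniformPoint : (k d : ℕ) → Dist (Point k d)
uniformPoint k d = indep d (λ _ → uniform (allFin (N k)))

-- Hypercubes H = ∏_i {a_i, b_i}, represented by the vector of pairs (a_i, b_i)

Cube : ℕ → ℕ → Set
Cube k d = Vec (Pt k × Pt k) d

pairsLt : {m : ℕ} → List (Fin m) → List (Fin m × Fin m)
pairsLt I = filter (λ p → proj₁ p <ᵇ proj₂ p ≟ᵇ true)
                   (concatMap (λ a → map (λ b → (a , b)) I) I)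
  where open import Data.Bool using () renaming (_≟_ to _≟ᵇ_)

hypercubeDist : (k d : ℕ) → Dist (Cube k d)
hypercubeDist k d = indep d (λ _ →
  uniform (scales k) >>= λ q →
  randInterval k q >>= λ I →
  uniform (pairsLt I))

hypercubeDistAt : (k d : ℕ) → Point k d → Dist (Cube k d)
hypercubeDistAt k d x = indep d (λ i →
  randPartner k (lookup x i) >>= λ c →
  return (if lookup x i <ᵇ c then (lookup x i , c) else (c , lookup x i)))

uniformInCube : (k d : ℕ) → Cube k d → Dist (Point k d)
uniformInCube k d H = indep d (λ i →
  uniform (proj₁ (lookup H i) ∷ proj₂ (lookup H i) ∷ []))

upCubeWalk : (k d τ : ℕ) → Cube k d → Point k d → Dist (Point k d)
upCubeWalk k d τ H x =
  uniform (subsetsOfSize d τ) >>= λ R →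
  return (Data.Vec.tabulate (λ r →
    if lookup R r ∧ ⌊ lookup x r ≟ᶠ proj₁ (lookup H r) ⌋
      then proj₂ (lookup H r) else lookup x r))
  where import Data.Vec

downCubeWalk : (k d τ : ℕ) → Cube k d → Point k d → Dist (Point k d)
downCubeWalk k d τ H x =
  uniform (subsetsOfSize d τ) >>= λ R →
  return (Data.Vec.tabulate (λ r →
    if lookup R r ∧ ⌊ lookup x r ≟ᶠ proj₂ (lookup H r) ⌋
      then proj₁ (lookup H r) else lookup x r))
  where import Data.Vec

Walk : ℕ → ℕ → Set
Walk k d = ℕ → Point k d → Dist (Point k d)

CubeWalk : ℕ → ℕ → Set
CubeWalk k d = ℕ → Cube k d → Point k d → Dist (Point k d)

dist₁ : (k d : ℕ) → Walk k d → ℕ → Dist (Point k d × Point k d)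
dist₁ k d W τ = uniformPoint k d >>= λ x → W τ x >>= λ y → return (x , y)

dist₂ : (k d : ℕ) → CubeWalk k d → ℕ → Dist (Point k d × Point k d)
dist₂ k d W τ =
  hypercubeDist k d >>= λ H → uniformInCube k d H >>= λ x → W τ H x >>= λ y → return (x , y)

dist₃ : (k d : ℕ) → CubeWalk k d → ℕ → Dist (Point k d × Point k d)
dist₃ k d W τ =
  uniformPoint k d >>= λ x → hypercubeDistAt k d x >>= λ H → W τ H x >>= λ y → return (x , y)

SameDist : (k d : ℕ) → Dist (Point k d × Point k d) → Dist (Point k d × Point k d) → Set
SameDist k d D E = ∀ o → Pr dec D o ≡ Pr dec E o
  where dec = ×-≡-dec (≡-dec _≟ᶠ_) (≡-dec _≟ᶠ_)

-- Every experiment draws the walk set R uniformly and then treats the coordinates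
-- independently, so Pr[(x , y) = (ox , oy)] is the average over R of a product of
-- one-coordinate probabilities, and it suffices to compare those.
-- In one coordinate the three laws are images of a single coupling: a uniform x with
-- a partner c (scale q, an interval I of size s = 2^q containing x, c uniform in
-- I ∖ {x}) has the same law as a uniform interval I of size s, a uniform pair a < b
-- in I, and x uniform in {a , b} with c the other endpoint. Both give each ordered
-- pair of distinct points of each interval the weight 1 / (n s (s - 1)), because
-- exactly s intervals of size s contain a given point and an interval has
-- s (s - 1) / 2 pairs. The hypercube walks move x to the other endpoint of its edge
-- in the walk's direction, which is what the walks do with the partner c.

{-# OPTIONS --safe #-}
module Submission where

open import Defs
open import Algebra.Bundles using (CommutativeMonoid)
import Algebra.Properties.CommutativeSemigroup as CommSemigroupProperties
import Algebra.Properties.CommutativeMonoid.Sum as CommMonoidSum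
open import Data.Bool using (Bool; true; false; if_then_else_; _∧_)
open import Data.Bool.Properties using (if-eta) renaming (_≟_ to _≟ᵇ_)
open import Data.Empty using (⊥-elim)
open import Data.Fin using (Fin; zero; suc; toℕ) renaming (_≟_ to _≟ᶠ_)
import Data.Fin.Properties as Finₚ
open import Data.Fin.Subset using (Subset)
open import Data.Integer using () renaming (+_ to ℤ+_)
import Data.Integer as ℤ
import Data.Integer.Properties as ℤₚ
open import Data.List using (List; []; _∷_; map; concatMap; filter; length; allFin; upTo; _++_)
open import Data.List.Membership.Propositional using (_∈_; _∉_)
open import Data.List.Membership.Propositional.Properties using (∈-filter⁻; ∈-map⁻; ∈-upTo⁻; ∈-allFin)
open import Data.List.Properties using (length-map; length-upTo; map-upTo; filter-all)
import Data.List.Relation.Unary.All as All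
open import Data.List.Relation.Unary.AllPairs using (_∷_)
open import Data.List.Relation.Unary.Any using (here; there)
open import Data.List.Relation.Unary.Unique.Propositional using (Unique)
import Data.List.Relation.Unary.Unique.Propositional.Properties as Uniqueₚ
open import Data.Nat as ℕ using (ℕ; zero; suc; _≤_; _<_; _^_; z≤n; s≤s; NonZero)
import Data.Nat.Coprimality as Coprime
open import Data.Nat.DivMod using (_%_; _mod_; m≡m%n+[m/n]*n; %-distribˡ-+; m%n%n≡m%n; [m+n]%n≡m%n; m<n⇒m%n≡m)
import Data.Nat.DivMod as ℕ÷
import Data.Nat.Properties as ℕₚ
open import Data.Product using (_×_; _,_; proj₁; proj₂; ∃)
open import Data.Product.Properties using () renaming (≡-dec to ×-≡-dec)
import Data.Rational as ℚ
open import Data.Rational using (ℚ; 0ℚ; 1ℚ; ½; _+_; _*_; mkℚ)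
open import Data.Rational.Properties
  using (1≢0; normalize-coprime; /-cong; *-inverseʳ; +-assoc; +-identityˡ; +-identityʳ; *-assoc; *-comm;
         *-identityˡ; *-identityʳ; *-zeroˡ; *-zeroʳ; *-distribˡ-+; *-distribʳ-+;
         +-0-commutativeMonoid; *-1-commutativeMonoid)
open import Data.Rational.Solver using (module +-*-Solver)
open import Data.Sum using (inj₁; inj₂; [_,_]′)
open import Data.Vec using (Vec; []; _∷_; lookup)
import Data.Vec as Vec
import Data.Vec.Properties as Vecₚ
open import Function using (_∘_)
open import Relation.Binary.Definitions using (DecidableEquality; tri<; tri≈; tri>)
open import Relation.Binary.PropositionalEquality
open import Relation.Nullary using (Dec; yes; no; ¬_; ¬?)
open import Relation.Nullary.Decidable using (⌊_⌋)
open import Relation.Nullary.Reflects using (Reflects; ofʸ; ofⁿ)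

open CommSemigroupProperties (CommutativeMonoid.commutativeSemigroup +-0-commutativeMonoid)
  using () renaming (interchange to +-interchange)
open CommSemigroupProperties (CommutativeMonoid.commutativeSemigroup *-1-commutativeMonoid)
  using () renaming (interchange to *-interchange; x∙yz≈y∙xz to x*[y*z]≡y*[x*z])
open CommMonoidSum *-1-commutativeMonoid using ()
  renaming (sum to ∏; sum-cong-≗ to ∏-cong; ∑-distrib-+ to ∏-distrib-*)

private variable A B : Set

-- Indicators, finite sums and expectations

when : Bool → ℚ → ℚ
when b x = if b then x else 0ℚ

⌊b≟true⌋≡b : (b : Bool) → ⌊ b ≟ᵇ true ⌋ ≡ b
⌊b≟true⌋≡b true = refl
⌊b≟true⌋≡b false = refl

𝟙 : {P : Set} → Dec P → ℚ
𝟙 (yes _) = 1ℚ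
𝟙 (no _) = 0ℚ

𝟙-yes : {P : Set} (p? : Dec P) → P → 𝟙 p? ≡ 1ℚ
𝟙-yes (yes _) _ = refl
𝟙-yes (no ¬p) p = ⊥-elim (¬p p)

𝟙-no : {P : Set} (p? : Dec P) → ¬ P → 𝟙 p? ≡ 0ℚ
𝟙-no (yes p) ¬p = ⊥-elim (¬p p)
𝟙-no (no _) _ = refl

𝟙-⇔ : {P Q : Set} (p? : Dec P) (q? : Dec Q) → (P → Q) → (Q → P) → 𝟙 p? ≡ 𝟙 q?
𝟙-⇔ (yes p) q? f _ = sym (𝟙-yes q? (f p))
𝟙-⇔ (no ¬p) q? _ g = sym (𝟙-no q? (¬p ∘ g))

𝟙-× : {P Q R : Set} (p? : Dec P) (q? : Dec Q) (r? : Dec R) →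
      (R → P × Q) → (P → Q → R) → 𝟙 r? ≡ 𝟙 p? * 𝟙 q?
𝟙-× (yes p) (yes q) r? _ g = 𝟙-yes r? (g p q)
𝟙-× (yes _) (no ¬q) r? f _ = trans (𝟙-no r? (¬q ∘ proj₂ ∘ f)) (sym (*-zeroʳ 1ℚ))
𝟙-× (no ¬p) q? r? f _ = trans (𝟙-no r? (¬p ∘ proj₁ ∘ f)) (sym (*-zeroˡ (𝟙 q?)))

∑ : List A → (A → ℚ) → ℚ
∑ [] f = 0ℚ
∑ (a ∷ as) f = f a + ∑ as f

∑-cong : (L : List A) {f g : A → ℚ} → (∀ a → f a ≡ g a) → ∑ L f ≡ ∑ L g
∑-cong [] _ = refl
∑-cong (a ∷ L) f≗g = cong₂ _+_ (f≗g a) (∑-cong L f≗g)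

∑-cong-∈ : (L : List A) {f g : A → ℚ} → (∀ a → a ∈ L → f a ≡ g a) → ∑ L f ≡ ∑ L g
∑-cong-∈ [] _ = refl
∑-cong-∈ (a ∷ L) f≗g = cong₂ _+_ (f≗g a (here refl)) (∑-cong-∈ L (λ b → f≗g b ∘ there))

∑-zero : (L : List A) → ∑ L (λ _ → 0ℚ) ≡ 0ℚ
∑-zero [] = refl
∑-zero (a ∷ L) = trans (+-identityˡ _) (∑-zero L)

∑-distrib-+ : (L : List A) (f g : A → ℚ) → ∑ L (λ a → f a + g a) ≡ ∑ L f + ∑ L g
∑-distrib-+ [] _ _ = sym (+-identityˡ 0ℚ)
∑-distrib-+ (a ∷ L) f g = trans (cong ((f a + g a) +_) (∑-distrib-+ L f g)) (+-interchange (f a) (g a) _ _)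

∑-*ˡ : (L : List A) (c : ℚ) (f : A → ℚ) → ∑ L (λ a → c * f a) ≡ c * ∑ L f
∑-*ˡ [] c _ = sym (*-zeroʳ c)
∑-*ˡ (a ∷ L) c f = trans (cong (c * f a +_) (∑-*ˡ L c f)) (sym (*-distribˡ-+ c (f a) _))

∑-++ : (L M : List A) (f : A → ℚ) → ∑ (L ++ M) f ≡ ∑ L f + ∑ M f
∑-++ [] M f = sym (+-identityˡ _)
∑-++ (a ∷ L) M f = trans (cong (f a +_) (∑-++ L M f)) (sym (+-assoc (f a) _ _))

∑-filter : {P : A → Set} (P? : ∀ a → Dec (P a)) (L : List A) (f : A → ℚ) →
           ∑ (filter P? L) f ≡ ∑ L (λ a → when ⌊ P? a ⌋ (f a))
∑-filter P? [] f = refl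
∑-filter P? (a ∷ L) f with P? a
... | yes _ = cong (f a +_) (∑-filter P? L f)
... | no _ = trans (∑-filter P? L f) (sym (+-identityˡ _))

∑-comm : (L : List A) (M : List B) (f : A → B → ℚ) →
         ∑ L (λ a → ∑ M (f a)) ≡ ∑ M (λ b → ∑ L (λ a → f a b))
∑-comm [] M f = sym (∑-zero M)
∑-comm (a ∷ L) M f = trans (cong (∑ M (f a) +_) (∑-comm L M f)) (sym (∑-distrib-+ M (f a) _))

∑-map : (g : A → B) (L : List A) (f : B → ℚ) → ∑ (map g L) f ≡ ∑ L (f ∘ g)
∑-map g [] f = refl
∑-map g (a ∷ L) f = cong (f (g a) +_) (∑-map g L f)

∑-concatMap : (g : A → List B) (L : List A) (f : B → ℚ) →
              ∑ (concatMap g L) f ≡ ∑ L (λ a → ∑ (g a) f)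
∑-concatMap g [] f = refl
∑-concatMap g (a ∷ L) f = trans (∑-++ (g a) (concatMap g L) f) (cong (∑ (g a) f +_) (∑-concatMap g L f))


𝔼 : Dist A → (A → ℚ) → ℚ
𝔼 [] h = 0ℚ
𝔼 ((w , a) ∷ D) h = w * h a + 𝔼 D h

𝔼-cong : (D : Dist A) {f g : A → ℚ} → (∀ a → f a ≡ g a) → 𝔼 D f ≡ 𝔼 D g
𝔼-cong [] _ = refl
𝔼-cong ((w , a) ∷ D) f≗g = cong₂ (λ x y → w * x + y) (f≗g a) (𝔼-cong D f≗g)

𝔼-zero : (D : Dist A) → 𝔼 D (λ _ → 0ℚ) ≡ 0ℚ
𝔼-zero [] = refl
𝔼-zero ((w , a) ∷ D) = trans (cong₂ _+_ (*-zeroʳ w) (𝔼-zero D)) (+-identityˡ 0ℚ)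

𝔼-distrib-+ : (D : Dist A) (f g : A → ℚ) → 𝔼 D (λ a → f a + g a) ≡ 𝔼 D f + 𝔼 D g
𝔼-distrib-+ [] _ _ = sym (+-identityˡ 0ℚ)
𝔼-distrib-+ ((w , a) ∷ D) f g =
  trans (cong₂ _+_ (*-distribˡ-+ w (f a) (g a)) (𝔼-distrib-+ D f g)) (+-interchange (w * f a) (w * g a) (𝔼 D f) (𝔼 D g))

𝔼-*ˡ : (D : Dist A) (c : ℚ) (f : A → ℚ) → 𝔼 D (λ a → c * f a) ≡ c * 𝔼 D f
𝔼-*ˡ [] c _ = sym (*-zeroʳ c)
𝔼-*ˡ ((w , a) ∷ D) c f = trans (cong₂ _+_ (x*[y*z]≡y*[x*z] w c (f a)) (𝔼-*ˡ D c f)) (sym (*-distribˡ-+ c _ _))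

𝔼-*ʳ : (D : Dist A) (c : ℚ) (f : A → ℚ) → 𝔼 D (λ a → f a * c) ≡ 𝔼 D f * c
𝔼-*ʳ D c f = trans (𝔼-cong D (λ a → *-comm (f a) c)) (trans (𝔼-*ˡ D c f) (*-comm c _))

𝔼-comm : (D : Dist A) (D′ : Dist B) (f : A → B → ℚ) →
         𝔼 D (λ a → 𝔼 D′ (f a)) ≡ 𝔼 D′ (λ b → 𝔼 D (λ a → f a b))
𝔼-comm [] D′ f = sym (𝔼-zero D′)
𝔼-comm ((w , a) ∷ D) D′ f =
  trans (cong₂ _+_ (sym (𝔼-*ˡ D′ w (f a))) (𝔼-comm D D′ f)) (sym (𝔼-distrib-+ D′ _ _))

𝔼-++ : (D D′ : Dist A) (h : A → ℚ) → 𝔼 (D ++ D′) h ≡ 𝔼 D h + 𝔼 D′ h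
𝔼-++ [] D′ h = sym (+-identityˡ _)
𝔼-++ ((w , a) ∷ D) D′ h = trans (cong (w * h a +_) (𝔼-++ D D′ h)) (sym (+-assoc (w * h a) _ _))

𝔼-return : (a : A) (h : A → ℚ) → 𝔼 (return a) h ≡ h a
𝔼-return a h = trans (+-identityʳ _) (*-identityˡ _)

𝔼-bind : (D : Dist A) (f : A → Dist B) (h : B → ℚ) → 𝔼 (D >>= f) h ≡ 𝔼 D (λ a → 𝔼 (f a) h)
𝔼-bind [] f h = refl
𝔼-bind {B = B} ((w , a) ∷ D) f h =
  trans (𝔼-++ (map (λ { (v , b) → (w * v , b) }) (f a)) (D >>= f) h) (cong₂ _+_ (𝔼-reweigh (f a)) (𝔼-bind D f h))
  where
  𝔼-reweigh : (D′ : Dist B) → 𝔼 (map (λ { (v , b) → (w * v , b) }) D′) h ≡ w * 𝔼 D′ h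
  𝔼-reweigh [] = sym (*-zeroʳ w)
  𝔼-reweigh ((v , b) ∷ D′) = trans (cong₂ _+_ (*-assoc w v (h b)) (𝔼-reweigh D′)) (sym (*-distribˡ-+ w _ _))

𝔼-bind-return : (D : Dist A) (f : A → B) (h : B → ℚ) → 𝔼 (D >>= λ a → return (f a)) h ≡ 𝔼 D (h ∘ f)
𝔼-bind-return D f h = trans (𝔼-bind D (λ a → return (f a)) h) (𝔼-cong D (λ a → 𝔼-return (f a) h))

Pr≡𝔼𝟙 : (_≟_ : (a b : A) → Dec (a ≡ b)) (D : Dist A) (o : A) → Pr _≟_ D o ≡ 𝔼 D (λ a → 𝟙 (a ≟ o))
Pr≡𝔼𝟙 _≟_ [] o = refl
Pr≡𝔼𝟙 _≟_ ((w , a) ∷ D) o with a ≟ o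
... | yes _ = cong₂ _+_ (sym (*-identityʳ w)) (Pr≡𝔼𝟙 _≟_ D o)
... | no _ = trans (Pr≡𝔼𝟙 _≟_ D o) (sym (trans (cong (_+ _) (*-zeroʳ w)) (+-identityˡ _)))

fromℕ : ℕ → ℚ
fromℕ n = mkℚ (ℤ+ n) 0 (Coprime.sym (Coprime.1-coprimeTo n))

fromℕ-suc : ∀ n → fromℕ (suc n) ≡ 1ℚ + fromℕ n
-- 1ℚ + fromℕ n unfolds to the normalisation of (1 * 1 + n * 1) / (1 * 1)
fromℕ-suc n = sym (trans
  (/-cong {ℤ._+_ (ℤ._*_ (ℤ+ 1) (ℤ+ 1)) (ℤ._*_ (ℤ+ n) (ℤ+ 1))} (cong (ℤ._+_ (ℤ+ 1)) (ℤₚ.*-identityʳ (ℤ+ n))) refl)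
  (normalize-coprime (Coprime.sym (Coprime.1-coprimeTo (suc n)))))

fromℕ-injective : ∀ {m n} → fromℕ m ≡ fromℕ n → m ≡ n
fromℕ-injective eq = ℤₚ.+-injective (cong ℚ.↥_ eq)

1/suc : ℕ → ℚ
1/suc m = ℤ+ 1 ℚ./ suc m

1/suc-inverse : ∀ m → 1/suc m * fromℕ (suc m) ≡ 1ℚ
1/suc-inverse m = trans (cong (_* fromℕ (suc m)) (normalize-coprime {1} {m} (Coprime.1-coprimeTo (suc m))))
                        (trans (*-comm (mkℚ (ℤ+ 1) m (Coprime.1-coprimeTo (suc m))) (fromℕ (suc m))) (*-inverseʳ (fromℕ (suc m))))

inverse-unique : ∀ x y n → x * n ≡ 1ℚ → y * n ≡ 1ℚ → x ≡ y
inverse-unique x y n xn≡1 yn≡1 = begin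
  x             ≡⟨ sym (*-identityʳ x) ⟩
  x * 1ℚ        ≡⟨ cong (x *_) (sym yn≡1) ⟩
  x * (y * n)   ≡⟨ cong (x *_) (*-comm y n) ⟩
  x * (n * y)   ≡⟨ sym (*-assoc x n y) ⟩
  (x * n) * y   ≡⟨ cong (_* y) xn≡1 ⟩
  1ℚ * y        ≡⟨ *-identityˡ y ⟩
  y             ∎
  where open ≡-Reasoning

∑-const : (L : List A) (c : ℚ) → ∑ L (λ _ → c) ≡ fromℕ (length L) * c
∑-const [] c = sym (*-zeroˡ c)
∑-const (a ∷ L) c = begin
  c + ∑ L (λ _ → c)                 ≡⟨ cong₂ _+_ (sym (*-identityˡ c)) (∑-const L c) ⟩
  1ℚ * c + fromℕ (length L) * c     ≡⟨ sym (*-distribʳ-+ c 1ℚ (fromℕ (length L))) ⟩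
  (1ℚ + fromℕ (length L)) * c       ≡⟨ cong (_* c) (sym (fromℕ-suc (length L))) ⟩
  fromℕ (suc (length L)) * c        ∎
  where open ≡-Reasoning

fromℕ-length-filter : {P : A → Set} (P? : ∀ a → Dec (P a)) (L : List A) →
                      fromℕ (length (filter P? L)) ≡ ∑ L (λ a → when ⌊ P? a ⌋ 1ℚ)
fromℕ-length-filter P? L =
  trans (sym (*-identityʳ _)) (trans (sym (∑-const (filter P? L) 1ℚ)) (∑-filter P? L (λ _ → 1ℚ)))

𝔼-uniform-∷ : (a : A) (L : List A) (f : A → ℚ) → 𝔼 (uniform (a ∷ L)) f ≡ 1/suc (length L) * ∑ (a ∷ L) f
𝔼-uniform-∷ {A = A} a L f = weighted (a ∷ L)
  where
  w : ℚ
  w = 1/suc (length L)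
  weighted : (M : List A) → 𝔼 (map (λ b → (w , b)) M) f ≡ w * ∑ M f
  weighted [] = sym (*-zeroʳ w)
  weighted (b ∷ M) = trans (cong (w * f b +_) (weighted M)) (sym (*-distribˡ-+ w (f b) (∑ M f)))

𝔼-uniform-inverse : (L : List A) (c : ℚ) (f : A → ℚ) → c * fromℕ (length L) ≡ 1ℚ →
                    𝔼 (uniform L) f ≡ c * ∑ L f
𝔼-uniform-inverse [] c f c*0≡1 = ⊥-elim (1≢0 (trans (sym c*0≡1) (*-zeroʳ c)))
𝔼-uniform-inverse (a ∷ L) c f c*n≡1 =
  trans (𝔼-uniform-∷ a L f)
        (cong (_* ∑ (a ∷ L) f) (inverse-unique (1/suc (length L)) c _ (1/suc-inverse (length L)) c*n≡1))

𝔼-uniform-length : (L : List A) {m : ℕ} (f : A → ℚ) → length L ≡ suc m → 𝔼 (uniform L) f ≡ 1/suc m * ∑ L f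
𝔼-uniform-length L {m} f len≡ = 𝔼-uniform-inverse L (1/suc m) f (trans (cong (λ n → 1/suc m * fromℕ n) len≡) (1/suc-inverse m))

𝔼-uniform-const : (L : List A) (c : ℚ) → 1 ≤ length L → 𝔼 (uniform L) (λ _ → c) ≡ c
𝔼-uniform-const (a ∷ L) c _ = begin
  𝔼 (uniform (a ∷ L)) (λ _ → c)                     ≡⟨ 𝔼-uniform-∷ a L (λ _ → c) ⟩
  1/suc (length L) * ∑ (a ∷ L) (λ _ → c)             ≡⟨ cong (1/suc (length L) *_) (∑-const (a ∷ L) c) ⟩
  1/suc (length L) * (fromℕ (suc (length L)) * c)    ≡⟨ sym (*-assoc (1/suc (length L)) (fromℕ (suc (length L))) c) ⟩
  (1/suc (length L) * fromℕ (suc (length L))) * c    ≡⟨ cong (_* c) (1/suc-inverse (length L)) ⟩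
  1ℚ * c                                             ≡⟨ *-identityˡ c ⟩
  c                                                  ∎
  where open ≡-Reasoning

𝔼-uniform-cong-∈ : (L : List A) {f g : A → ℚ} → (∀ a → a ∈ L → f a ≡ g a) → 𝔼 (uniform L) f ≡ 𝔼 (uniform L) g
𝔼-uniform-cong-∈ [] _ = refl
𝔼-uniform-cong-∈ (a ∷ L) {f} {g} f≗g = begin
  𝔼 (uniform (a ∷ L)) f                ≡⟨ 𝔼-uniform-∷ a L f ⟩
  1/suc (length L) * ∑ (a ∷ L) f        ≡⟨ cong (1/suc (length L) *_) (∑-cong-∈ (a ∷ L) f≗g) ⟩
  1/suc (length L) * ∑ (a ∷ L) g        ≡⟨ sym (𝔼-uniform-∷ a L g) ⟩
  𝔼 (uniform (a ∷ L)) g                ∎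
  where open ≡-Reasoning

𝔼-uniform-∑-comm : (L : List A) (F : A → A → ℚ) →
                   𝔼 (uniform L) (λ a → ∑ L (F a)) ≡ 𝔼 (uniform L) (λ b → ∑ L (λ a → F a b))
𝔼-uniform-∑-comm [] F = refl
𝔼-uniform-∑-comm (a ∷ L) F = begin
  𝔼 (uniform (a ∷ L)) (λ x → ∑ (a ∷ L) (F x))                  ≡⟨ 𝔼-uniform-∷ a L _ ⟩
  1/suc (length L) * ∑ (a ∷ L) (λ x → ∑ (a ∷ L) (F x))          ≡⟨ cong (1/suc (length L) *_) (∑-comm (a ∷ L) (a ∷ L) F) ⟩
  1/suc (length L) * ∑ (a ∷ L) (λ y → ∑ (a ∷ L) (λ x → F x y))  ≡⟨ sym (𝔼-uniform-∷ a L _) ⟩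
  𝔼 (uniform (a ∷ L)) (λ y → ∑ (a ∷ L) (λ x → F x y))          ∎
  where open ≡-Reasoning

𝔼-indep : (d : ℕ) (f : Fin d → Dist A) (h : Fin d → A → ℚ) →
          𝔼 (indep d f) (λ v → ∏ (λ i → h i (lookup v i))) ≡ ∏ (λ i → 𝔼 (f i) (h i))
𝔼-indep {A = A} zero f h = 𝔼-return {A = Vec A 0} [] (λ _ → 1ℚ)
𝔼-indep {A = A} (suc d) f h = begin
  𝔼 (indep (suc d) f) H
    ≡⟨ 𝔼-bind (f zero) _ H ⟩
  𝔼 (f zero) (λ a → 𝔼 (tail >>= λ as → return (a ∷ as)) H)
    ≡⟨ 𝔼-cong (f zero) (λ a → 𝔼-bind tail (λ as → return (a ∷ as)) H) ⟩
  𝔼 (f zero) (λ a → 𝔼 tail (λ as → 𝔼 (return (a ∷ as)) H))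
    ≡⟨ 𝔼-cong (f zero) (λ a → 𝔼-cong tail (λ as → 𝔼-return (a ∷ as) H)) ⟩
  𝔼 (f zero) (λ a → 𝔼 tail (λ as → h zero a * ∏ (λ i → h (suc i) (lookup as i))))
    ≡⟨ 𝔼-cong (f zero) (λ a → 𝔼-*ˡ tail (h zero a) _) ⟩
  𝔼 (f zero) (λ a → h zero a * 𝔼 tail (λ as → ∏ (λ i → h (suc i) (lookup as i))))
    ≡⟨ 𝔼-cong (f zero) (λ a → cong (h zero a *_) (𝔼-indep d (f ∘ suc) (h ∘ suc))) ⟩
  𝔼 (f zero) (λ a → h zero a * ∏ (λ i → 𝔼 (f (suc i)) (h (suc i))))
    ≡⟨ 𝔼-*ʳ (f zero) _ (h zero) ⟩
  𝔼 (f zero) (h zero) * ∏ (λ i → 𝔼 (f (suc i)) (h (suc i)))   ∎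
  where
  open ≡-Reasoning
  tail : Dist (Vec A d)
  tail = indep d (f ∘ suc)
  H : Vec A (suc d) → ℚ
  H v = ∏ (λ i → h i (lookup v i))

𝔼-indep₂ : (d : ℕ) (f : Fin d → Dist A) (g : Fin d → A → Dist B) (h : Fin d → A → B → ℚ) →
           𝔼 (indep d f) (λ u → 𝔼 (indep d (λ i → g i (lookup u i))) (λ v → ∏ (λ i → h i (lookup u i) (lookup v i))))
           ≡ ∏ (λ i → 𝔼 (f i) (λ a → 𝔼 (g i a) (h i a)))
𝔼-indep₂ d f g h =
  trans (𝔼-cong (indep d f) (λ u → 𝔼-indep d (λ i → g i (lookup u i)) (λ i → h i (lookup u i))))
        (𝔼-indep d f (λ i a → 𝔼 (g i a) (h i a)))

𝟙-Vec : {d : ℕ} (_≟_ : DecidableEquality A) (v o : Vec A d) (v≟o : Dec (v ≡ o)) →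
        𝟙 v≟o ≡ ∏ (λ i → 𝟙 (lookup v i ≟ lookup o i))
𝟙-Vec _≟_ [] [] v≟o = 𝟙-yes v≟o refl
𝟙-Vec _≟_ (a ∷ v) (b ∷ o) v≟o =
  trans (𝟙-× (a ≟ b) (Vecₚ.≡-dec _≟_ v o) v≟o Vecₚ.∷-injective (cong₂ _∷_))
        (cong (𝟙 (a ≟ b) *_) (𝟙-Vec _≟_ v o (Vecₚ.≡-dec _≟_ v o)))

𝟙-Vec-pair : {d : ℕ} (_≟_ : DecidableEquality A) (x y ox oy : Vec A d) (r : Dec ((x , y) ≡ (ox , oy))) →
             𝟙 r ≡ ∏ (λ i → 𝟙 (lookup x i ≟ lookup ox i) * 𝟙 (lookup y i ≟ lookup oy i))
𝟙-Vec-pair {A = A} {d} _≟_ x y ox oy r = begin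
  𝟙 r
    ≡⟨ 𝟙-× (x ≟ᵛ ox) (y ≟ᵛ oy) r (λ { refl → refl , refl }) (λ { refl refl → refl }) ⟩
  𝟙 (x ≟ᵛ ox) * 𝟙 (y ≟ᵛ oy)
    ≡⟨ cong₂ _*_ (𝟙-Vec _≟_ x ox (x ≟ᵛ ox)) (𝟙-Vec _≟_ y oy (y ≟ᵛ oy)) ⟩
  ∏ (λ i → 𝟙 (lookup x i ≟ lookup ox i)) * ∏ (λ i → 𝟙 (lookup y i ≟ lookup oy i))
    ≡⟨ sym (∏-distrib-* {d} _ _) ⟩
  ∏ (λ i → 𝟙 (lookup x i ≟ lookup ox i) * 𝟙 (lookup y i ≟ lookup oy i))   ∎
  where
  open ≡-Reasoning
  _≟ᵛ_ : DecidableEquality (Vec A d)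
  _≟ᵛ_ = Vecₚ.≡-dec _≟_

module _ {m : ℕ} where

  ∈ᵇ⇒∈ : {x : Fin m} (L : List (Fin m)) → x ∈ᵇ L ≡ true → x ∈ L
  ∈ᵇ⇒∈ {x} (a ∷ L) x∈ᵇL with x ≟ᶠ a
  ... | yes refl = here refl
  ... | no _ = there (∈ᵇ⇒∈ L x∈ᵇL)

  ∈⇒∈ᵇ : {x : Fin m} {L : List (Fin m)} → x ∈ L → x ∈ᵇ L ≡ true
  ∈⇒∈ᵇ {x} {a ∷ L} x∈L with x ≟ᶠ a | x∈L
  ... | yes _ | _ = refl
  ... | no x≢a | here x≡a = ⊥-elim (x≢a x≡a)
  ... | no _ | there x∈L′ = ∈⇒∈ᵇ x∈L′

  ∉⇒∈ᵇ≡false : {x : Fin m} (L : List (Fin m)) → x ∉ L → x ∈ᵇ L ≡ false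
  ∉⇒∈ᵇ≡false {x} L x∉L with x ∈ᵇ L in x∈ᵇL
  ... | true = ⊥-elim (x∉L (∈ᵇ⇒∈ L x∈ᵇL))
  ... | false = refl

  count : Fin m → List (Fin m) → ℚ
  count x L = ∑ L (λ y → 𝟙 (x ≟ᶠ y))

  count-Unique : {x : Fin m} {L : List (Fin m)} → Unique L → count x L ≡ when (x ∈ᵇ L) 1ℚ
  count-Unique {L = []} _ = refl
  count-Unique {x} {a ∷ L} a∷L-unique@(_ ∷ L-unique) with x ≟ᶠ a
  ... | yes refl = begin
    1ℚ + count x L                         ≡⟨ cong (1ℚ +_) (count-Unique L-unique) ⟩
    1ℚ + when (x ∈ᵇ L) 1ℚ       ≡⟨ cong (λ b → 1ℚ + when b 1ℚ) x∉ᵇL ⟩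
    1ℚ + 0ℚ                                ≡⟨ +-identityʳ 1ℚ ⟩
    1ℚ                                     ∎
    where
    open ≡-Reasoning
    x∉ᵇL : x ∈ᵇ L ≡ false
    x∉ᵇL = ∉⇒∈ᵇ≡false L (Uniqueₚ.Unique[x∷xs]⇒x∉xs a∷L-unique)
  ... | no _ = trans (+-identityˡ _) (count-Unique L-unique)

  count-allFin : (y : Fin m) → count y (allFin m) ≡ 1ℚ
  count-allFin y = trans (count-Unique (Uniqueₚ.allFin⁺ m)) (cong (λ b → when b 1ℚ) (∈⇒∈ᵇ (∈-allFin y)))

  ∑-allFin-δ : (y : Fin m) (g : Fin m → ℚ) → ∑ (allFin m) (λ x → g x * 𝟙 (x ≟ᶠ y)) ≡ g y
  ∑-allFin-δ y g = begin
    ∑ (allFin m) (λ x → g x * 𝟙 (x ≟ᶠ y))     ≡⟨ ∑-cong (allFin m) 𝟙-swap ⟩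
    ∑ (allFin m) (λ x → g y * 𝟙 (y ≟ᶠ x))     ≡⟨ ∑-*ˡ (allFin m) (g y) _ ⟩
    g y * count y (allFin m)                 ≡⟨ cong (g y *_) (count-allFin y) ⟩
    g y * 1ℚ                                 ≡⟨ *-identityʳ (g y) ⟩
    g y                                      ∎
    where
    open ≡-Reasoning
    𝟙-swap : ∀ x → g x * 𝟙 (x ≟ᶠ y) ≡ g y * 𝟙 (y ≟ᶠ x)
    𝟙-swap x with x ≟ᶠ y | y ≟ᶠ x
    ... | yes refl | yes _ = refl
    ... | yes refl | no y≢y = ⊥-elim (y≢y refl)
    ... | no x≢y | yes y≡x = ⊥-elim (x≢y (sym y≡x))
    ... | no _ | no _ = trans (*-zeroʳ (g x)) (sym (*-zeroʳ (g y)))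

  ∑-allFin-∈ᵇ : {L : List (Fin m)} → Unique L → (g : Fin m → ℚ) →
                ∑ (allFin m) (λ x → when (x ∈ᵇ L) (g x)) ≡ ∑ L g
  ∑-allFin-∈ᵇ {L} L-unique g = begin
    ∑ (allFin m) (λ x → when (x ∈ᵇ L) (g x))          ≡⟨ ∑-cong (allFin m) as-count ⟩
    ∑ (allFin m) (λ x → ∑ L (λ y → g x * 𝟙 (x ≟ᶠ y)))  ≡⟨ ∑-comm (allFin m) L _ ⟩
    ∑ L (λ y → ∑ (allFin m) (λ x → g x * 𝟙 (x ≟ᶠ y)))  ≡⟨ ∑-cong L (λ y → ∑-allFin-δ y g) ⟩
    ∑ L g                                             ∎
    where
    open ≡-Reasoning
    as-count : ∀ x → when (x ∈ᵇ L) (g x) ≡ ∑ L (λ y → g x * 𝟙 (x ≟ᶠ y))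
    as-count x = begin
      when (x ∈ᵇ L) (g x)            ≡⟨ when-*1 (x ∈ᵇ L) ⟩
      g x * when (x ∈ᵇ L) 1ℚ         ≡⟨ cong (g x *_) (sym (count-Unique L-unique)) ⟩
      g x * count x L                ≡⟨ sym (∑-*ˡ L (g x) _) ⟩
      ∑ L (λ y → g x * 𝟙 (x ≟ᶠ y))   ∎
      where
      when-*1 : ∀ b → when b (g x) ≡ g x * when b 1ℚ
      when-*1 true = sym (*-identityʳ (g x))
      when-*1 false = sym (*-zeroʳ (g x))

  length-others : {x : Fin m} {L : List (Fin m)} → Unique L → x ∈ L →
                  suc (length (filter (λ c → ¬? (c ≟ᶠ x)) L)) ≡ length L
  length-others {x} {a ∷ L} (a≢L ∷ L-unique) x∈a∷L with a ≟ᶠ x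
  ... | yes refl = cong suc (cong length (filter-all (λ c → ¬? (c ≟ᶠ x)) (All.map (λ x≢c c≡x → x≢c (sym c≡x)) a≢L)))
  ... | no a≢x with x∈a∷L
  ...   | here x≡a = ⊥-elim (a≢x (sym x≡a))
  ...   | there x∈L = cong suc (length-others L-unique x∈L)

-- Wrap-around intervals

module _ (n : ℕ) .{{_ : NonZero n}} where

  %-injective-window : ∀ {a b} → a ≤ b → b < a ℕ.+ n → a % n ≡ b % n → a ≡ b
  %-injective-window {a} {b} a≤b b<a+n a%n≡b%n with ℕₚ.m≤n⇒m<n∨m≡n (ℕ÷./-monoˡ-≤ n a≤b)
  ... | inj₂ a/n≡b/n = begin
    a                     ≡⟨ m≡m%n+[m/n]*n a n ⟩
    a % n ℕ.+ a ℕ./ n ℕ.* n   ≡⟨ cong₂ (λ r q → r ℕ.+ q ℕ.* n) a%n≡b%n a/n≡b/n ⟩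
    b % n ℕ.+ b ℕ./ n ℕ.* n   ≡⟨ sym (m≡m%n+[m/n]*n b n) ⟩
    b                     ∎
    where open ≡-Reasoning
  ... | inj₁ a/n<b/n = ⊥-elim (ℕₚ.<⇒≱ b<a+n a+n≤b)
    where
    open ℕₚ.≤-Reasoning
    a+n≤b : a ℕ.+ n ≤ b
    a+n≤b = begin
      a ℕ.+ n                             ≡⟨ cong (ℕ._+ n) (m≡m%n+[m/n]*n a n) ⟩
      a % n ℕ.+ a ℕ./ n ℕ.* n ℕ.+ n       ≡⟨ ℕₚ.+-assoc (a % n) _ n ⟩
      a % n ℕ.+ (a ℕ./ n ℕ.* n ℕ.+ n)     ≡⟨ cong (a % n ℕ.+_) (ℕₚ.+-comm (a ℕ./ n ℕ.* n) n) ⟩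
      a % n ℕ.+ suc (a ℕ./ n) ℕ.* n       ≤⟨ ℕₚ.+-monoʳ-≤ (a % n) (ℕₚ.*-monoˡ-≤ n a/n<b/n) ⟩
      a % n ℕ.+ b ℕ./ n ℕ.* n             ≡⟨ cong (ℕ._+ b ℕ./ n ℕ.* n) a%n≡b%n ⟩
      b % n ℕ.+ b ℕ./ n ℕ.* n             ≡⟨ sym (m≡m%n+[m/n]*n b n) ⟩
      b                                   ∎

  [m+i]%n≡[m+j]%n⇒i≡j : ∀ m {i j} → i < n → j < n → (m ℕ.+ i) % n ≡ (m ℕ.+ j) % n → i ≡ j
  [m+i]%n≡[m+j]%n⇒i≡j m {i} {j} i<n j<n eq =
    [ (λ i≤j → ordered i≤j j<n eq) , (λ j≤i → sym (ordered j≤i i<n (sym eq))) ]′ (ℕₚ.≤-total i j)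
    where
    ordered : ∀ {i j} → i ≤ j → j < n → (m ℕ.+ i) % n ≡ (m ℕ.+ j) % n → i ≡ j
    ordered {i} {j} i≤j j<n eq = ℕₚ.+-cancelˡ-≡ m i j (%-injective-window (ℕₚ.+-monoʳ-≤ m i≤j) window eq)
      where
      window : m ℕ.+ j < m ℕ.+ i ℕ.+ n
      window = subst (m ℕ.+ j <_) (sym (ℕₚ.+-assoc m i n)) (ℕₚ.+-monoʳ-< m (ℕₚ.<-≤-trans j<n (ℕₚ.m≤n+m n i)))

module Intervals (k : ℕ) where

  instance
    N-nonZero : NonZero (N k)
    N-nonZero = nzN k

  shift : Pt k → ℕ → Pt k
  shift st j = (toℕ st ℕ.+ j) mod N k

  toℕ-shift : ∀ st j → toℕ (shift st j) ≡ (toℕ st ℕ.+ j) % N k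
  toℕ-shift st j = Finₚ.toℕ-fromℕ< _

  shift-injectiveʳ : ∀ st {i j} → i < N k → j < N k → shift st i ≡ shift st j → i ≡ j
  shift-injectiveʳ st {i} {j} i<n j<n eq = [m+i]%n≡[m+j]%n⇒i≡j (N k) (toℕ st) i<n j<n
    (trans (sym (toℕ-shift st i)) (trans (cong toℕ eq) (toℕ-shift st j)))

  shift-injectiveˡ : ∀ {st st′} j → shift st j ≡ shift st′ j → st ≡ st′
  shift-injectiveˡ {st} {st′} j eq = Finₚ.toℕ-injective
    ([m+i]%n≡[m+j]%n⇒i≡j (N k) j (Finₚ.toℕ<n st) (Finₚ.toℕ<n st′)
      (subst₂ (λ a b → a % N k ≡ b % N k) (ℕₚ.+-comm (toℕ st) j) (ℕₚ.+-comm (toℕ st′) j)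
        (trans (sym (toℕ-shift st j)) (trans (cong toℕ eq) (toℕ-shift st′ j)))))

  -- the witness is the start x + (n - j), which reaches x after j steps
  shift-surjective : ∀ x j → j ≤ N k → ∃ λ st → shift st j ≡ x
  shift-surjective x j j≤n = st , Finₚ.toℕ-injective (begin
    toℕ (shift st j)                     ≡⟨ toℕ-shift st j ⟩
    (toℕ st ℕ.+ j) % n                   ≡⟨ cong (λ r → (r ℕ.+ j) % n) (Finₚ.toℕ-fromℕ< _) ⟩
    (a % n ℕ.+ j) % n                    ≡⟨ %-distribˡ-+ (a % n) j n ⟩
    (a % n % n ℕ.+ j % n) % n            ≡⟨ cong (λ r → (r ℕ.+ j % n) % n) (m%n%n≡m%n a n) ⟩
    (a % n ℕ.+ j % n) % n                ≡⟨ sym (%-distribˡ-+ a j n) ⟩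
    (a ℕ.+ j) % n                        ≡⟨ cong (_% n) (ℕₚ.+-assoc (toℕ x) (n ℕ.∸ j) j) ⟩
    (toℕ x ℕ.+ (n ℕ.∸ j ℕ.+ j)) % n      ≡⟨ cong (λ r → (toℕ x ℕ.+ r) % n) (ℕₚ.m∸n+n≡m j≤n) ⟩
    (toℕ x ℕ.+ n) % n                    ≡⟨ [m+n]%n≡m%n (toℕ x) n ⟩
    toℕ x % n                            ≡⟨ m<n⇒m%n≡m (Finₚ.toℕ<n x) ⟩
    toℕ x                                ∎)
    where
    open ≡-Reasoning
    n a : ℕ
    n = N k
    a = toℕ x ℕ.+ (n ℕ.∸ j)
    st : Pt k
    st = a mod n

  length-interval : ∀ st s → length (interval k st s) ≡ s
  length-interval st s = trans (length-map (shift st) (upTo s)) (length-upTo s)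

  interval-Unique : ∀ st s → s ≤ N k → Unique (interval k st s)
  interval-Unique st s s≤n = subst Unique (sym (map-upTo (shift st) s))
    (Uniqueₚ.applyUpTo⁺₁ (shift st) s (λ i<j j<s eq →
      ℕₚ.<⇒≢ i<j (shift-injectiveʳ st (ℕₚ.<-trans i<j (ℕₚ.<-≤-trans j<s s≤n)) (ℕₚ.<-≤-trans j<s s≤n) eq)))

  starts : Pt k → ℕ → List (Pt k)
  starts x s = filter (λ st → x ∈ᵇ interval k st s ≟ᵇ true) (allFin (N k))

  length-starts : ∀ x s → s ≤ N k → length (starts x s) ≡ s
  length-starts x s s≤n = fromℕ-injective (begin
    fromℕ (length (starts x s))
      ≡⟨ fromℕ-length-filter (λ st → x ∈ᵇ interval k st s ≟ᵇ true) (allFin (N k)) ⟩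
    ∑ (allFin (N k)) (λ st → when ⌊ x ∈ᵇ interval k st s ≟ᵇ true ⌋ 1ℚ)
      ≡⟨ ∑-cong (allFin (N k)) (λ st → cong (λ b → when b 1ℚ) (⌊b≟true⌋≡b (x ∈ᵇ interval k st s))) ⟩
    ∑ (allFin (N k)) (λ st → when (x ∈ᵇ interval k st s) 1ℚ)
      ≡⟨ ∑-cong (allFin (N k)) (λ st → sym (count-Unique (interval-Unique st s s≤n))) ⟩
    ∑ (allFin (N k)) (λ st → count x (interval k st s))
      ≡⟨ ∑-cong (allFin (N k)) (λ st → ∑-map (shift st) (upTo s) (λ y → 𝟙 (x ≟ᶠ y))) ⟩
    ∑ (allFin (N k)) (λ st → ∑ (upTo s) (λ j → 𝟙 (x ≟ᶠ shift st j)))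
      ≡⟨ ∑-comm (allFin (N k)) (upTo s) _ ⟩
    ∑ (upTo s) (λ j → ∑ (allFin (N k)) (λ st → 𝟙 (x ≟ᶠ shift st j)))
      ≡⟨ ∑-cong-∈ (upTo s) (λ j j∈ → unique-start j (ℕₚ.<⇒≤ (ℕₚ.<-≤-trans (∈-upTo⁻ j∈) s≤n))) ⟩
    ∑ (upTo s) (λ _ → 1ℚ)
      ≡⟨ trans (∑-const (upTo s) 1ℚ) (trans (*-identityʳ _) (cong fromℕ (length-upTo s))) ⟩
    fromℕ s ∎)
    where
    open ≡-Reasoning
    unique-start : ∀ j → j ≤ N k → ∑ (allFin (N k)) (λ st → 𝟙 (x ≟ᶠ shift st j)) ≡ 1ℚ
    unique-start j j≤n with shift-surjective x j j≤n
    ... | st₀ , shift-st₀≡x = trans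
      (∑-cong (allFin (N k)) (λ st → 𝟙-⇔ (x ≟ᶠ shift st j) (st₀ ≟ᶠ st)
        (λ x≡ → shift-injectiveˡ j (trans shift-st₀≡x x≡)) (λ { refl → sym shift-st₀≡x })))
      (count-allFin st₀)

module _ {m : ℕ} where

  <ᵇ-reflects : (a b : Fin m) → Reflects (toℕ a < toℕ b) (a <ᵇ b)
  <ᵇ-reflects a b = ℕₚ.<ᵇ-reflects-< (toℕ a) (toℕ b)

  <ᵇ-true : {a b : Fin m} → toℕ a < toℕ b → a <ᵇ b ≡ true
  <ᵇ-true {a} {b} a<b with a <ᵇ b | <ᵇ-reflects a b
  ... | true | _ = refl
  ... | false | ofⁿ a≮b = ⊥-elim (a≮b a<b)

  <ᵇ-false : {a b : Fin m} → ¬ toℕ a < toℕ b → a <ᵇ b ≡ false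
  <ᵇ-false {a} {b} a≮b with a <ᵇ b | <ᵇ-reflects a b
  ... | true | ofʸ a<b = ⊥-elim (a≮b a<b)
  ... | false | _ = refl

  <ᵇ-+-<ᵇ : (a b : Fin m) (u : ℚ) →
            when (a <ᵇ b) u + when (b <ᵇ a) u ≡ when ⌊ ¬? (b ≟ᶠ a) ⌋ u
  <ᵇ-+-<ᵇ a b u with Finₚ.<-cmp a b | b ≟ᶠ a
  ... | tri< a<b _ b≮a | no _ rewrite <ᵇ-true a<b | <ᵇ-false b≮a = +-identityʳ u
  ... | tri> a≮b _ b<a | no _ rewrite <ᵇ-false a≮b | <ᵇ-true b<a = +-identityˡ u
  ... | tri≈ a≮a _ _ | yes refl rewrite <ᵇ-false a≮a = +-identityˡ 0ℚ
  ... | tri≈ _ a≡b _ | no b≢a = ⊥-elim (b≢a (sym a≡b))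
  ... | tri< a<a _ _ | yes refl = ⊥-elim (ℕₚ.<-irrefl refl a<a)
  ... | tri> _ _ a<a | yes refl = ⊥-elim (ℕₚ.<-irrefl refl a<a)

  when-+ : (b : Bool) (u v : ℚ) → when b (u + v) ≡ when b u + when b v
  when-+ true u v = refl
  when-+ false u v = sym (+-identityˡ 0ℚ)

  ∑-pairsLt : (L : List (Fin m)) (ψ : Fin m × Fin m → ℚ) →
              ∑ (pairsLt L) ψ ≡ ∑ L (λ a → ∑ L (λ b → when (a <ᵇ b) (ψ (a , b))))
  ∑-pairsLt L ψ = begin
    ∑ (pairsLt L) ψ
      ≡⟨ ∑-filter (λ p → proj₁ p <ᵇ proj₂ p ≟ᵇ true) (concatMap (λ a → map (a ,_) L) L) ψ ⟩
    ∑ (concatMap (λ a → map (a ,_) L) L) (λ p → when ⌊ proj₁ p <ᵇ proj₂ p ≟ᵇ true ⌋ (ψ p))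
      ≡⟨ ∑-concatMap (λ a → map (a ,_) L) L _ ⟩
    ∑ L (λ a → ∑ (map (a ,_) L) (λ p → when ⌊ proj₁ p <ᵇ proj₂ p ≟ᵇ true ⌋ (ψ p)))
      ≡⟨ ∑-cong L (λ a → trans (∑-map (a ,_) L _)
           (∑-cong L (λ b → cong (λ c → when c (ψ (a , b))) (⌊b≟true⌋≡b (a <ᵇ b))))) ⟩
    ∑ L (λ a → ∑ L (λ b → when (a <ᵇ b) (ψ (a , b))))   ∎
    where open ≡-Reasoning

  ∑-<ᵇ-symmetrize : (L : List (Fin m)) (h : Fin m → Fin m → ℚ) →
                    ∑ L (λ a → ∑ L (λ b → when (a <ᵇ b) (h a b + h b a)))
                    ≡ ∑ L (λ a → ∑ L (λ b → when ⌊ ¬? (b ≟ᶠ a) ⌋ (h a b)))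
  ∑-<ᵇ-symmetrize L h = begin
    ∑ L (λ a → ∑ L (λ b → when (a <ᵇ b) (h a b + h b a)))
      ≡⟨ ∑-cong L (λ a → trans (∑-cong L (λ b → when-+ (a <ᵇ b) (h a b) (h b a))) (∑-distrib-+ L _ _)) ⟩
    ∑ L (λ a → ∑ L (λ b → when (a <ᵇ b) (h a b)) + ∑ L (λ b → when (a <ᵇ b) (h b a)))
      ≡⟨ ∑-distrib-+ L _ _ ⟩
    ∑ L (λ a → ∑ L (λ b → when (a <ᵇ b) (h a b))) + ∑ L (λ a → ∑ L (λ b → when (a <ᵇ b) (h b a)))
      ≡⟨ cong (∑ L (λ a → ∑ L (λ b → when (a <ᵇ b) (h a b))) +_) (∑-comm L L (λ a b → when (a <ᵇ b) (h b a))) ⟩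
    ∑ L (λ a → ∑ L (λ b → when (a <ᵇ b) (h a b))) + ∑ L (λ a → ∑ L (λ b → when (b <ᵇ a) (h a b)))
      ≡⟨ sym (∑-distrib-+ L _ _) ⟩
    ∑ L (λ a → ∑ L (λ b → when (a <ᵇ b) (h a b)) + ∑ L (λ b → when (b <ᵇ a) (h a b)))
      ≡⟨ ∑-cong L (λ a → trans (sym (∑-distrib-+ L _ _)) (∑-cong L (λ b → <ᵇ-+-<ᵇ a b (h a b)))) ⟩
    ∑ L (λ a → ∑ L (λ b → when ⌊ ¬? (b ≟ᶠ a) ⌋ (h a b)))   ∎
    where open ≡-Reasoning

  pairsLt-double : {L : List (Fin m)} {t : ℕ} → Unique L → length L ≡ suc t →
                   fromℕ (length (pairsLt L)) + fromℕ (length (pairsLt L)) ≡ fromℕ (suc t) * fromℕ t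
  pairsLt-double {L} {t} L-unique length≡ = begin
    #pairs + #pairs
      ≡⟨ cong₂ _+_ #pairs≡ #pairs≡ ⟩
    ∑ L (λ a → ∑ L (λ b → when (a <ᵇ b) 1ℚ)) + ∑ L (λ a → ∑ L (λ b → when (a <ᵇ b) 1ℚ))
      ≡⟨ sym (∑-distrib-+ L _ _) ⟩
    ∑ L (λ a → ∑ L (λ b → when (a <ᵇ b) 1ℚ) + ∑ L (λ b → when (a <ᵇ b) 1ℚ))
      ≡⟨ ∑-cong L (λ a → trans (sym (∑-distrib-+ L _ _)) (∑-cong L (λ b → sym (when-+ (a <ᵇ b) 1ℚ 1ℚ)))) ⟩
    ∑ L (λ a → ∑ L (λ b → when (a <ᵇ b) (1ℚ + 1ℚ)))
      ≡⟨ ∑-<ᵇ-symmetrize L (λ _ _ → 1ℚ) ⟩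
    ∑ L (λ a → ∑ L (λ b → when ⌊ ¬? (b ≟ᶠ a) ⌋ 1ℚ))
      ≡⟨ ∑-cong-∈ L (λ a a∈L → trans (sym (fromℕ-length-filter (λ c → ¬? (c ≟ᶠ a)) L))
           (cong fromℕ (ℕₚ.suc-injective (trans (length-others L-unique a∈L) length≡)))) ⟩
    ∑ L (λ _ → fromℕ t)
      ≡⟨ ∑-const L (fromℕ t) ⟩
    fromℕ (length L) * fromℕ t
      ≡⟨ cong (λ l → fromℕ l * fromℕ t) length≡ ⟩
    fromℕ (suc t) * fromℕ t   ∎
    where
    open ≡-Reasoning
    #pairs : ℚ
    #pairs = fromℕ (length (pairsLt L))
    #pairs≡ : #pairs ≡ ∑ L (λ a → ∑ L (λ b → when (a <ᵇ b) 1ℚ))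
    #pairs≡ = trans (sym (*-identityʳ _)) (trans (sym (∑-const (pairsLt L) 1ℚ)) (∑-pairsLt L (λ _ → 1ℚ)))

  ∑-pairsLt-symmetric : (L : List (Fin m)) (h : Fin m → Fin m → ℚ) (ψ : Fin m × Fin m → ℚ) →
                        (∀ a b → toℕ a < toℕ b → ψ (a , b) ≡ 1/suc 1 * (h a b + h b a)) →
                        ∑ (pairsLt L) ψ ≡ 1/suc 1 * ∑ L (λ a → ∑ L (λ b → when ⌊ ¬? (b ≟ᶠ a) ⌋ (h a b)))
  ∑-pairsLt-symmetric L h ψ ψ-sym = begin
    ∑ (pairsLt L) ψ
      ≡⟨ ∑-pairsLt L ψ ⟩
    ∑ L (λ a → ∑ L (λ b → when (a <ᵇ b) (ψ (a , b))))
      ≡⟨ ∑-cong L (λ a → ∑-cong L (λ b → on-pair a b)) ⟩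
    ∑ L (λ a → ∑ L (λ b → 1/suc 1 * when (a <ᵇ b) (h a b + h b a)))
      ≡⟨ trans (∑-cong L (λ a → ∑-*ˡ L (1/suc 1) _)) (∑-*ˡ L (1/suc 1) _) ⟩
    1/suc 1 * ∑ L (λ a → ∑ L (λ b → when (a <ᵇ b) (h a b + h b a)))
      ≡⟨ cong (1/suc 1 *_) (∑-<ᵇ-symmetrize L h) ⟩
    1/suc 1 * ∑ L (λ a → ∑ L (λ b → when ⌊ ¬? (b ≟ᶠ a) ⌋ (h a b)))   ∎
    where
    open ≡-Reasoning
    on-pair : ∀ a b → when (a <ᵇ b) (ψ (a , b)) ≡ 1/suc 1 * when (a <ᵇ b) (h a b + h b a)
    on-pair a b with a <ᵇ b | <ᵇ-reflects a b
    ... | true | ofʸ a<b = ψ-sym a b a<b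
    ... | false | _ = sym (*-zeroʳ (1/suc 1))

module _ {m : ℕ} where

  order : Fin m → Fin m → Fin m × Fin m
  order x c = if x <ᵇ c then (x , c) else (c , x)

  moveUp moveDown : Fin m → Fin m → Fin m
  moveUp x c = if x <ᵇ c then c else x
  moveDown x c = if c <ᵇ x then c else x

  movedIf : (Fin m → Fin m → Fin m) → Bool → Fin m → Fin m → Fin m
  movedIf move b x c = if b then move x c else x

  cubeUp cubeDown : Bool → Fin m × Fin m → Fin m → Fin m
  cubeUp b p x = if b ∧ ⌊ x ≟ᶠ proj₁ p ⌋ then proj₂ p else x
  cubeDown b p x = if b ∧ ⌊ x ≟ᶠ proj₂ p ⌋ then proj₁ p else x

  ⌊x≟x⌋ : (x : Fin m) → ⌊ x ≟ᶠ x ⌋ ≡ true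
  ⌊x≟x⌋ x with x ≟ᶠ x
  ... | yes _ = refl
  ... | no x≢x = ⊥-elim (x≢x refl)

  cubeUp-order : ∀ b x c → cubeUp b (order x c) x ≡ movedIf moveUp b x c
  cubeUp-order false x c = refl
  cubeUp-order true x c with x <ᵇ c
  ... | true rewrite ⌊x≟x⌋ x = refl
  ... | false = if-eta ⌊ x ≟ᶠ c ⌋

  cubeUp-lo : ∀ b x c → toℕ x < toℕ c → cubeUp b (x , c) x ≡ movedIf moveUp b x c
  cubeUp-lo false x c _ = refl
  cubeUp-lo true x c x<c rewrite ⌊x≟x⌋ x | <ᵇ-true x<c = refl

  cubeUp-hi : ∀ b x c → toℕ x < toℕ c → cubeUp b (x , c) c ≡ movedIf moveUp b c x
  cubeUp-hi false x c _ = refl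
  cubeUp-hi true x c x<c rewrite <ᵇ-false (ℕₚ.<⇒≯ x<c) = if-eta ⌊ c ≟ᶠ x ⌋

  cubeDown-order : ∀ b x c → cubeDown b (order x c) x ≡ movedIf moveDown b x c
  cubeDown-order false x c = refl
  cubeDown-order true x c with x <ᵇ c | <ᵇ-reflects x c | c <ᵇ x | <ᵇ-reflects c x
  ... | true | ofʸ x<c | true | ofʸ c<x = ⊥-elim (ℕₚ.<-asym x<c c<x)
  ... | true | _ | false | _ = if-eta ⌊ x ≟ᶠ c ⌋
  ... | false | _ | true | _ rewrite ⌊x≟x⌋ x = refl
  ... | false | ofⁿ x≮c | false | ofⁿ c≮x rewrite ⌊x≟x⌋ x =
    Finₚ.toℕ-injective (ℕₚ.≤-antisym (ℕₚ.≮⇒≥ x≮c) (ℕₚ.≮⇒≥ c≮x))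

  cubeDown-lo : ∀ b x c → toℕ x < toℕ c → cubeDown b (x , c) x ≡ movedIf moveDown b x c
  cubeDown-lo false x c _ = refl
  cubeDown-lo true x c x<c rewrite <ᵇ-false (ℕₚ.<⇒≯ x<c) = if-eta ⌊ x ≟ᶠ c ⌋

  cubeDown-hi : ∀ b x c → toℕ x < toℕ c → cubeDown b (x , c) c ≡ movedIf moveDown b c x
  cubeDown-hi false x c _ = refl
  cubeDown-hi true x c x<c rewrite ⌊x≟x⌋ c | <ᵇ-true x<c = refl

-- The one-dimensional coupling

2^suc≡2+ : ∀ q → ∃ λ t → 2 ^ suc q ≡ suc (suc t)
2^suc≡2+ q with 2 ^ q | ℕₚ.m^n>0 2 q
... | suc u | _ = u ℕ.+ u , cong suc (trans (ℕₚ.+-suc u (u ℕ.+ 0)) (cong (λ v → suc (u ℕ.+ v)) (ℕₚ.+-identityʳ u)))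

module Coupling (k : ℕ) where
  open Intervals k

  U : Dist (Pt k)
  U = uniform (allFin (N k))

  others : Pt k → List (Pt k) → List (Pt k)
  others x I = filter (λ c → ¬? (c ≟ᶠ x)) I

  intervalContaining : ℕ → Pt k → Dist (List (Pt k))
  intervalContaining s x = uniform (starts x s) >>= λ st → return (interval k st s)

  ∑-others : (I : List (Pt k)) (h : Pt k → Pt k → ℚ) → Pt k → ℚ
  ∑-others I h x = ∑ I (λ c → when ⌊ ¬? (c ≟ᶠ x) ⌋ (h x c))

  distinctPairSum : (Pt k → Pt k → ℚ) → Pt k → ℕ → ℚ
  distinctPairSum h st s = ∑ (interval k st s) (∑-others (interval k st s) h)

  length-others-interval : ∀ {s t x st} → s ≡ suc (suc t) → s ≤ N k → st ∈ starts x s →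
                           length (others x (interval k st s)) ≡ suc t
  length-others-interval {s} {t} {x} {st} s≡ s≤n st∈ = ℕₚ.suc-injective (begin
    suc (length (others x (interval k st s)))  ≡⟨ length-others (interval-Unique st s s≤n) x∈interval ⟩
    length (interval k st s)                   ≡⟨ length-interval st s ⟩
    s                                          ≡⟨ s≡ ⟩
    suc (suc t)                                ∎)
    where
    open ≡-Reasoning
    x∈interval : x ∈ interval k st s
    x∈interval = ∈ᵇ⇒∈ (interval k st s)
                   (proj₂ (∈-filter⁻ (λ st → x ∈ᵇ interval k st s ≟ᵇ true) {xs = allFin (N k)} st∈))

  partner-by-scale : ∀ x (f : Pt k → ℚ) →
    𝔼 (randPartner k x) f ≡ 𝔼 (uniform (scales k)) (λ q → 𝔼 (intervalContaining (2 ^ q) x) (λ I → 𝔼 (uniform (others x I)) f))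
  partner-by-scale x f = trans (𝔼-bind (uniform (scales k)) _ f)
    (𝔼-cong (uniform (scales k)) (λ q → 𝔼-bind (intervalContaining (2 ^ q) x) (λ I → uniform (others x I)) f))

  𝔼-partner-at-scale : (h : Pt k → Pt k → ℚ) {s t : ℕ} → s ≡ suc (suc t) → s ≤ N k →
    𝔼 U (λ x → 𝔼 (intervalContaining s x) (λ I → 𝔼 (uniform (others x I)) (h x)))
    ≡ (1/suc (suc t) * 1/suc t) * 𝔼 U (λ st → distinctPairSum h st s)
  𝔼-partner-at-scale h {s} {t} s≡ s≤n = begin
    𝔼 U (λ x → 𝔼 (intervalContaining s x) (λ I → 𝔼 (uniform (others x I)) (h x)))
      ≡⟨ 𝔼-cong U (λ x → 𝔼-bind-return (uniform (starts x s)) (λ st → interval k st s) _) ⟩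
    𝔼 U (λ x → 𝔼 (uniform (starts x s)) (λ st → 𝔼 (uniform (others x (I st))) (h x)))
      ≡⟨ 𝔼-cong U (λ x → 𝔼-uniform-cong-∈ (starts x s) (𝔼-others x)) ⟩
    𝔼 U (λ x → 𝔼 (uniform (starts x s)) (λ st → 1/suc t * ∑-others (I st) h x))
      ≡⟨ 𝔼-cong U (λ x → 𝔼-uniform-length (starts x s) _ (trans (length-starts x s s≤n) s≡)) ⟩
    𝔼 U (λ x → 1/suc (suc t) * ∑ (starts x s) (λ st → 1/suc t * ∑-others (I st) h x))
      ≡⟨ 𝔼-cong U (λ x → cong (1/suc (suc t) *_) (trans (∑-*ˡ (starts x s) (1/suc t) _) (cong (1/suc t *_) (∑-starts x)))) ⟩
    𝔼 U (λ x → 1/suc (suc t) * (1/suc t * ∑ (allFin (N k)) (λ st → when (x ∈ᵇ I st) (∑-others (I st) h x))))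
      ≡⟨ trans (𝔼-*ˡ U (1/suc (suc t)) _) (trans (cong (1/suc (suc t) *_) (𝔼-*ˡ U (1/suc t) F))
                                                (sym (*-assoc (1/suc (suc t)) (1/suc t) (𝔼 U F)))) ⟩
    (1/suc (suc t) * 1/suc t) * 𝔼 U (λ x → ∑ (allFin (N k)) (λ st → when (x ∈ᵇ I st) (∑-others (I st) h x)))
      ≡⟨ cong ((1/suc (suc t) * 1/suc t) *_) (𝔼-uniform-∑-comm (allFin (N k)) _) ⟩
    (1/suc (suc t) * 1/suc t) * 𝔼 U (λ st → ∑ (allFin (N k)) (λ x → when (x ∈ᵇ I st) (∑-others (I st) h x)))
      ≡⟨ cong ((1/suc (suc t) * 1/suc t) *_) (𝔼-cong U (λ st → ∑-allFin-∈ᵇ (interval-Unique st s s≤n) (∑-others (I st) h))) ⟩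
    (1/suc (suc t) * 1/suc t) * 𝔼 U (λ st → distinctPairSum h st s)   ∎
    where
    open ≡-Reasoning
    I : Pt k → List (Pt k)
    I st = interval k st s
    F : Pt k → ℚ
    F x = ∑ (allFin (N k)) (λ st → when (x ∈ᵇ I st) (∑-others (I st) h x))
    𝔼-others : ∀ x st → st ∈ starts x s → 𝔼 (uniform (others x (I st))) (h x) ≡ 1/suc t * ∑-others (I st) h x
    𝔼-others x st st∈ = trans (𝔼-uniform-length (others x (I st)) (h x) (length-others-interval s≡ s≤n st∈))
                              (cong (1/suc t *_) (∑-filter (λ c → ¬? (c ≟ᶠ x)) (I st) (h x)))
    ∑-starts : ∀ x {F : Pt k → ℚ} → ∑ (starts x s) F ≡ ∑ (allFin (N k)) (λ st → when (x ∈ᵇ I st) (F st))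
    ∑-starts x {F} = trans (∑-filter _ (allFin (N k)) F)
      (∑-cong (allFin (N k)) (λ st → cong (λ b → when b (F st)) (⌊b≟true⌋≡b (x ∈ᵇ I st))))

  𝔼-pairs-at-scale : (h : Pt k → Pt k → ℚ) (ψ : Pt k × Pt k → ℚ) →
                     (∀ a b → toℕ a < toℕ b → ψ (a , b) ≡ ½ * (h a b + h b a)) →
                     {s t : ℕ} → s ≡ suc (suc t) → s ≤ N k →
    𝔼 U (λ st → 𝔼 (uniform (pairsLt (interval k st s))) ψ)
    ≡ (1/suc (suc t) * 1/suc t) * 𝔼 U (λ st → distinctPairSum h st s)
  𝔼-pairs-at-scale h ψ ψ-sym {s} {t} s≡ s≤n = trans (𝔼-cong U per-start) (𝔼-*ˡ U c _)
    where
    open +-*-Solver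
    c : ℚ
    c = 1/suc (suc t) * 1/suc t
    2*½≡1 : (1ℚ + 1ℚ) * ½ ≡ 1ℚ
    2*½≡1 = refl
    per-start : ∀ st → 𝔼 (uniform (pairsLt (interval k st s))) ψ ≡ c * distinctPairSum h st s
    per-start st = begin
      𝔼 (uniform P) ψ
        ≡⟨ 𝔼-uniform-inverse P (c * (1ℚ + 1ℚ)) ψ weight ⟩
      (c * (1ℚ + 1ℚ)) * ∑ P ψ
        ≡⟨ cong ((c * (1ℚ + 1ℚ)) *_) (∑-pairsLt-symmetric I h ψ ψ-sym) ⟩
      (c * (1ℚ + 1ℚ)) * (½ * T)
        ≡⟨ solve 3 (λ c h T → (c :* (con 1ℚ :+ con 1ℚ)) :* (h :* T) := c :* (((con 1ℚ :+ con 1ℚ) :* h) :* T)) refl c ½ T ⟩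
      c * (((1ℚ + 1ℚ) * ½) * T)
        ≡⟨ cong (λ r → c * (r * T)) 2*½≡1 ⟩
      c * (1ℚ * T)
        ≡⟨ cong (c *_) (*-identityˡ T) ⟩
      c * T   ∎
      where
      open ≡-Reasoning
      I : List (Pt k)
      I = interval k st s
      P : List (Pt k × Pt k)
      P = pairsLt I
      T : ℚ
      T = distinctPairSum h st s
      #P : ℚ
      #P = fromℕ (length P)
      -- an interval of size t + 2 has (t + 2) (t + 1) / 2 pairs
      weight : (c * (1ℚ + 1ℚ)) * #P ≡ 1ℚ
      weight = begin
        (c * (1ℚ + 1ℚ)) * #P
          ≡⟨ solve 3 (λ a b p → (a :* b :* (con 1ℚ :+ con 1ℚ)) :* p := (a :* b) :* (p :+ p)) refl (1/suc (suc t)) (1/suc t) #P ⟩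
        c * (#P + #P)
          ≡⟨ cong (c *_) (pairsLt-double (interval-Unique st s s≤n) (trans (length-interval st s) s≡)) ⟩
        c * (fromℕ (suc (suc t)) * fromℕ (suc t))
          ≡⟨ *-interchange (1/suc (suc t)) (1/suc t) (fromℕ (suc (suc t))) (fromℕ (suc t)) ⟩
        (1/suc (suc t) * fromℕ (suc (suc t))) * (1/suc t * fromℕ (suc t))
          ≡⟨ cong₂ _*_ (1/suc-inverse (suc t)) (1/suc-inverse t) ⟩
        1ℚ * 1ℚ
          ≡⟨ *-identityˡ 1ℚ ⟩
        1ℚ ∎

  𝔼-partner-mass-at-scale : ∀ x {s t} → s ≡ suc (suc t) → s ≤ N k →
                            𝔼 (intervalContaining s x) (λ I → 𝔼 (uniform (others x I)) (λ _ → 1ℚ)) ≡ 1ℚ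
  𝔼-partner-mass-at-scale x {s} s≡ s≤n = begin
    𝔼 (intervalContaining s x) (λ I → 𝔼 (uniform (others x I)) (λ _ → 1ℚ))
      ≡⟨ 𝔼-bind-return (uniform (starts x s)) (λ st → interval k st s) _ ⟩
    𝔼 (uniform (starts x s)) (λ st → 𝔼 (uniform (others x (interval k st s))) (λ _ → 1ℚ))
      ≡⟨ 𝔼-uniform-cong-∈ (starts x s) (λ st st∈ →
           𝔼-uniform-const (others x (interval k st s)) 1ℚ (subst (1 ≤_) (sym (length-others-interval s≡ s≤n st∈)) (s≤s z≤n))) ⟩
    𝔼 (uniform (starts x s)) (λ _ → 1ℚ)
      ≡⟨ 𝔼-uniform-const (starts x s) 1ℚ (subst (1 ≤_) (sym (trans (length-starts x s s≤n) s≡)) (s≤s z≤n)) ⟩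
    1ℚ ∎
    where open ≡-Reasoning

  𝔼-scales-cong : {f g : ℕ → ℚ} → (∀ q {t} → 2 ^ q ≡ suc (suc t) → 2 ^ q ≤ N k → f q ≡ g q) →
                  𝔼 (uniform (scales k)) f ≡ 𝔼 (uniform (scales k)) g
  𝔼-scales-cong {f} {g} f≗g = 𝔼-uniform-cong-∈ (scales k) on-scale
    where
    on-scale : ∀ q → q ∈ scales k → f q ≡ g q
    on-scale q q∈ with ∈-map⁻ suc q∈
    ... | j , j∈ , refl = f≗g (suc j) (proj₂ (2^suc≡2+ j)) (ℕₚ.^-monoʳ-≤ 2 (∈-upTo⁻ j∈))

  randPair : Dist (Pt k × Pt k)
  randPair = uniform (scales k) >>= λ q → randInterval k q >>= λ I → uniform (pairsLt I)

  -- for k = 0 there is no scale and randPartner k x is the empty distribution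
  partner-mass : 1 ≤ k → ∀ x → 𝔼 (randPartner k x) (λ _ → 1ℚ) ≡ 1ℚ
  partner-mass 1≤k x = begin
    𝔼 (randPartner k x) (λ _ → 1ℚ)
      ≡⟨ partner-by-scale x (λ _ → 1ℚ) ⟩
    𝔼 (uniform (scales k)) (λ q → 𝔼 (intervalContaining (2 ^ q) x) (λ I → 𝔼 (uniform (others x I)) (λ _ → 1ℚ)))
      ≡⟨ 𝔼-scales-cong (λ q 2^q≡ 2^q≤n → 𝔼-partner-mass-at-scale x 2^q≡ 2^q≤n) ⟩
    𝔼 (uniform (scales k)) (λ _ → 1ℚ)
      ≡⟨ 𝔼-uniform-const (scales k) 1ℚ (subst (1 ≤_) (sym (trans (length-map suc (upTo k)) (length-upTo k))) 1≤k) ⟩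
    1ℚ ∎
    where open ≡-Reasoning

  orderedPartner : Pt k → Dist (Pt k × Pt k)
  orderedPartner x = randPartner k x >>= λ c → return (order x c)

  partner-coupling : (h : Pt k → Pt k → ℚ) (ψ : Pt k × Pt k → ℚ) →
                     (∀ a b → toℕ a < toℕ b → ψ (a , b) ≡ ½ * (h a b + h b a)) →
                     𝔼 U (λ x → 𝔼 (randPartner k x) (h x)) ≡ 𝔼 randPair ψ
  partner-coupling h ψ ψ-sym = begin
    𝔼 U (λ x → 𝔼 (randPartner k x) (h x))
      ≡⟨ 𝔼-cong U (λ x → partner-by-scale x (h x)) ⟩
    𝔼 U (λ x → 𝔼 (uniform (scales k)) (λ q → 𝔼 (intervalContaining (2 ^ q) x) (λ I → 𝔼 (uniform (others x I)) (h x))))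
      ≡⟨ 𝔼-comm U (uniform (scales k)) _ ⟩
    𝔼 (uniform (scales k)) (λ q → 𝔼 U (λ x → 𝔼 (intervalContaining (2 ^ q) x) (λ I → 𝔼 (uniform (others x I)) (h x))))
      ≡⟨ 𝔼-scales-cong (λ q 2^q≡ 2^q≤n →
           trans (𝔼-partner-at-scale h 2^q≡ 2^q≤n) (sym (𝔼-pairs-at-scale h ψ ψ-sym 2^q≡ 2^q≤n))) ⟩
    𝔼 (uniform (scales k)) (λ q → 𝔼 U (λ st → 𝔼 (uniform (pairsLt (interval k st (2 ^ q)))) ψ))
      ≡⟨ 𝔼-cong (uniform (scales k)) (λ q → sym (trans (𝔼-bind (randInterval k q) _ ψ) (𝔼-bind-return U _ _))) ⟩
    𝔼 (uniform (scales k)) (λ q → 𝔼 (randInterval k q >>= λ I → uniform (pairsLt I)) ψ)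
      ≡⟨ sym (𝔼-bind (uniform (scales k)) _ ψ) ⟩
    𝔼 randPair ψ ∎
    where open ≡-Reasoning

module CoordinateLaws (k : ℕ) (1≤k : 1 ≤ k) (move : Pt k → Pt k → Pt k) (cube : Bool → Pt k × Pt k → Pt k → Pt k)
  (cube-order : ∀ b x c → cube b (order x c) x ≡ movedIf move b x c)
  (cube-lo : ∀ b x c → toℕ x < toℕ c → cube b (x , c) x ≡ movedIf move b x c)
  (cube-hi : ∀ b x c → toℕ x < toℕ c → cube b (x , c) c ≡ movedIf move b c x)
  where
  open Coupling k

  walkStep : Bool → Pt k → Dist (Pt k)
  walkStep b x = if b then (randPartner k x >>= λ c → return (move x c)) else return x

  𝔼-walkStep : ∀ b x (φ : Pt k → ℚ) → 𝔼 (walkStep b x) φ ≡ 𝔼 (randPartner k x) (λ c → φ (movedIf move b x c))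
  𝔼-walkStep true x φ = 𝔼-bind-return (randPartner k x) (move x) φ
  𝔼-walkStep false x φ = begin
    𝔼 (return x) φ                            ≡⟨ 𝔼-return x φ ⟩
    φ x                                       ≡⟨ sym (*-identityʳ (φ x)) ⟩
    φ x * 1ℚ                                  ≡⟨ cong (φ x *_) (sym (partner-mass 1≤k x)) ⟩
    φ x * 𝔼 (randPartner k x) (λ _ → 1ℚ)      ≡⟨ sym (𝔼-*ˡ (randPartner k x) (φ x) (λ _ → 1ℚ)) ⟩
    𝔼 (randPartner k x) (λ _ → φ x * 1ℚ)      ≡⟨ 𝔼-cong (randPartner k x) (λ _ → *-identityʳ (φ x)) ⟩
    𝔼 (randPartner k x) (λ _ → φ x)           ∎
    where open ≡-Reasoning

  module _ (b : Bool) (ox oy : Pt k) where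

    walkLaw cubeLaw partnerCubeLaw : ℚ
    walkLaw = 𝔼 U (λ x → 𝔼 (walkStep b x) (λ y → 𝟙 (x ≟ᶠ ox) * 𝟙 (y ≟ᶠ oy)))
    cubeLaw = 𝔼 randPair (λ p → 𝔼 (uniform (proj₁ p ∷ proj₂ p ∷ [])) (λ x → 𝟙 (x ≟ᶠ ox) * 𝟙 (cube b p x ≟ᶠ oy)))
    partnerCubeLaw = 𝔼 U (λ x → 𝔼 (orderedPartner x) (λ p → 𝟙 (x ≟ᶠ ox) * 𝟙 (cube b p x ≟ᶠ oy)))

    hit : Pt k → Pt k → ℚ
    hit x c = 𝟙 (x ≟ᶠ ox) * 𝟙 (movedIf move b x c ≟ᶠ oy)

    walkLaw-via-partner : walkLaw ≡ 𝔼 U (λ x → 𝔼 (randPartner k x) (hit x))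
    walkLaw-via-partner = 𝔼-cong U (λ x → 𝔼-walkStep b x (λ y → 𝟙 (x ≟ᶠ ox) * 𝟙 (y ≟ᶠ oy)))

    walkLaw≡cubeLaw : walkLaw ≡ cubeLaw
    walkLaw≡cubeLaw = trans walkLaw-via-partner (partner-coupling hit _ endpoints)
      where
      endpoints : ∀ a c → toℕ a < toℕ c →
                  𝔼 (uniform (a ∷ c ∷ [])) (λ x → 𝟙 (x ≟ᶠ ox) * 𝟙 (cube b (a , c) x ≟ᶠ oy)) ≡ ½ * (hit a c + hit c a)
      endpoints a c a<c = trans (𝔼-uniform-∷ a (c ∷ []) (λ x → 𝟙 (x ≟ᶠ ox) * 𝟙 (cube b (a , c) x ≟ᶠ oy)))
        (cong (½ *_) (cong₂ _+_
          (cong (λ z → 𝟙 (a ≟ᶠ ox) * 𝟙 (z ≟ᶠ oy)) (cube-lo b a c a<c))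
          (trans (+-identityʳ _) (cong (λ z → 𝟙 (c ≟ᶠ ox) * 𝟙 (z ≟ᶠ oy)) (cube-hi b a c a<c)))))

    walkLaw≡partnerCubeLaw : walkLaw ≡ partnerCubeLaw
    walkLaw≡partnerCubeLaw = trans walkLaw-via-partner (𝔼-cong U (λ x → sym (trans
      (𝔼-bind-return (randPartner k x) (order x) _)
      (𝔼-cong (randPartner k x) (λ c → cong (λ z → 𝟙 (x ≟ᶠ ox) * 𝟙 (z ≟ᶠ oy)) (cube-order b x c))))))

-- Factorisation over the coordinates

module Factorisation (k d : ℕ) where
  open Coupling k using (U; randPair; orderedPartner)

  walk : (Bool → Pt k → Dist (Pt k)) → Walk k d
  walk step τ x = uniform (subsetsOfSize d τ) >>= λ R → indep d (λ r → step (lookup R r) (lookup x r))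

  cubeWalk : (Bool → Pt k × Pt k → Pt k → Pt k) → CubeWalk k d
  cubeWalk cube τ H x = uniform (subsetsOfSize d τ) >>= λ R →
    return (Vec.tabulate (λ r → cube (lookup R r) (lookup H r) (lookup x r)))

  module _ (τ : ℕ) (_≟ᵖ_ : DecidableEquality (Point k d × Point k d)) (ox oy : Point k d) where

    S : List (Subset d)
    S = subsetsOfSize d τ

    event : Point k d × Point k d → ℚ
    event o = 𝟙 (o ≟ᵖ (ox , oy))

    hits : Fin d → Pt k → Pt k → ℚ
    hits i x y = 𝟙 (x ≟ᶠ lookup ox i) * 𝟙 (y ≟ᶠ lookup oy i)

    cubeHits : (Bool → Pt k × Pt k → Pt k → Pt k) → Subset d → Cube k d → Point k d → ℚ
    cubeHits cube R H x = ∏ (λ i → hits i (lookup x i) (cube (lookup R i) (lookup H i) (lookup x i)))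

    𝔼-pair : (D : Dist (Point k d)) (x : Point k d) →
             𝔼 (D >>= λ y → return (x , y)) event
             ≡ 𝔼 D (λ y → ∏ (λ i → hits i (lookup x i) (lookup y i)))
    𝔼-pair D x = trans (𝔼-bind-return D (x ,_) _) (𝔼-cong D (λ y → 𝟙-Vec-pair _≟ᶠ_ x y ox oy ((x , y) ≟ᵖ (ox , oy))))

    𝔼-cubeWalk : (cube : Bool → Pt k × Pt k → Pt k → Pt k) (H : Cube k d) (x : Point k d) →
                 𝔼 (cubeWalk cube τ H x >>= λ y → return (x , y)) event ≡ 𝔼 (uniform S) (λ R → cubeHits cube R H x)
    𝔼-cubeWalk cube H x = trans (𝔼-pair (cubeWalk cube τ H x) x)
      (trans (𝔼-bind-return (uniform S) _ _)
        (𝔼-cong (uniform S) (λ R → ∏-cong (λ i → cong (hits i (lookup x i)) (Vecₚ.lookup∘tabulate _ i)))))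

    Pr-walk : (step : Bool → Pt k → Dist (Pt k)) →
      Pr _≟ᵖ_ (dist₁ k d (walk step) τ) (ox , oy)
      ≡ 𝔼 (uniform S) (λ R → ∏ (λ i → 𝔼 U (λ x → 𝔼 (step (lookup R i) x) (hits i x))))
    Pr-walk step = begin
      Pr _≟ᵖ_ (dist₁ k d (walk step) τ) (ox , oy)
        ≡⟨ Pr≡𝔼𝟙 _≟ᵖ_ (dist₁ k d (walk step) τ) (ox , oy) ⟩
      𝔼 (uniformPoint k d >>= λ x → walk step τ x >>= λ y → return (x , y)) event
        ≡⟨ 𝔼-bind (uniformPoint k d) _ _ ⟩
      𝔼 (uniformPoint k d) (λ x → 𝔼 (walk step τ x >>= λ y → return (x , y)) event)
        ≡⟨ 𝔼-cong (uniformPoint k d) (λ x → trans (𝔼-pair (walk step τ x) x) (𝔼-bind (uniform S) _ _)) ⟩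
      𝔼 (uniformPoint k d) (λ x → 𝔼 (uniform S) (λ R → 𝔼 (steps R x) (λ y → ∏ (λ i → hits i (lookup x i) (lookup y i)))))
        ≡⟨ 𝔼-comm (uniformPoint k d) (uniform S) _ ⟩
      𝔼 (uniform S) (λ R → 𝔼 (uniformPoint k d) (λ x → 𝔼 (steps R x) (λ y → ∏ (λ i → hits i (lookup x i) (lookup y i)))))
        ≡⟨ 𝔼-cong (uniform S) (λ R → 𝔼-indep₂ d (λ _ → U) (λ i → step (lookup R i)) hits) ⟩
      𝔼 (uniform S) (λ R → ∏ (λ i → 𝔼 U (λ x → 𝔼 (step (lookup R i) x) (hits i x))))   ∎
      where
      open ≡-Reasoning
      steps : Subset d → Point k d → Dist (Point k d)
      steps R x = indep d (λ r → step (lookup R r) (lookup x r))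

    Pr-cubeWalk : (cube : Bool → Pt k × Pt k → Pt k → Pt k) →
      Pr _≟ᵖ_ (dist₂ k d (cubeWalk cube) τ) (ox , oy)
      ≡ 𝔼 (uniform S) (λ R → ∏ (λ i → 𝔼 randPair (λ p → 𝔼 (uniform (proj₁ p ∷ proj₂ p ∷ [])) (λ x → hits i x (cube (lookup R i) p x)))))
    Pr-cubeWalk cube = begin
      Pr _≟ᵖ_ (dist₂ k d (cubeWalk cube) τ) (ox , oy)
        ≡⟨ Pr≡𝔼𝟙 _≟ᵖ_ (dist₂ k d (cubeWalk cube) τ) (ox , oy) ⟩
      𝔼 (hypercubeDist k d >>= λ H → uniformInCube k d H >>= λ x → cubeWalk cube τ H x >>= λ y → return (x , y)) event
        ≡⟨ 𝔼-bind (hypercubeDist k d) _ event ⟩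
      𝔼 (hypercubeDist k d) (λ H → 𝔼 (uniformInCube k d H >>= λ x → cubeWalk cube τ H x >>= λ y → return (x , y)) event)
        ≡⟨ 𝔼-cong (hypercubeDist k d) (λ H → trans (𝔼-bind (uniformInCube k d H) _ event)
             (𝔼-cong (uniformInCube k d H) (𝔼-cubeWalk cube H))) ⟩
      𝔼 (hypercubeDist k d) (λ H → 𝔼 (uniformInCube k d H) (λ x → 𝔼 (uniform S) (λ R → cubeHits cube R H x)))
        ≡⟨ 𝔼-cong (hypercubeDist k d) (λ H → 𝔼-comm (uniformInCube k d H) (uniform S) _) ⟩
      𝔼 (hypercubeDist k d) (λ H → 𝔼 (uniform S) (λ R → 𝔼 (uniformInCube k d H) (cubeHits cube R H)))
        ≡⟨ 𝔼-comm (hypercubeDist k d) (uniform S) _ ⟩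
      𝔼 (uniform S) (λ R → 𝔼 (hypercubeDist k d) (λ H → 𝔼 (uniformInCube k d H) (cubeHits cube R H)))
        ≡⟨ 𝔼-cong (uniform S) (λ R → 𝔼-indep₂ d (λ _ → randPair) (λ _ p → uniform (proj₁ p ∷ proj₂ p ∷ []))
             (λ i p x → hits i x (cube (lookup R i) p x))) ⟩
      𝔼 (uniform S) (λ R → ∏ (λ i → 𝔼 randPair (λ p → 𝔼 (uniform (proj₁ p ∷ proj₂ p ∷ [])) (λ x → hits i x (cube (lookup R i) p x)))))   ∎
      where open ≡-Reasoning

    Pr-partnerCubeWalk : (cube : Bool → Pt k × Pt k → Pt k → Pt k) →
      Pr _≟ᵖ_ (dist₃ k d (cubeWalk cube) τ) (ox , oy)
      ≡ 𝔼 (uniform S) (λ R → ∏ (λ i → 𝔼 U (λ x → 𝔼 (orderedPartner x) (λ p → hits i x (cube (lookup R i) p x)))))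
    Pr-partnerCubeWalk cube = begin
      Pr _≟ᵖ_ (dist₃ k d (cubeWalk cube) τ) (ox , oy)
        ≡⟨ Pr≡𝔼𝟙 _≟ᵖ_ (dist₃ k d (cubeWalk cube) τ) (ox , oy) ⟩
      𝔼 (uniformPoint k d >>= λ x → hypercubeDistAt k d x >>= λ H → cubeWalk cube τ H x >>= λ y → return (x , y)) event
        ≡⟨ 𝔼-bind (uniformPoint k d) _ event ⟩
      𝔼 (uniformPoint k d) (λ x → 𝔼 (hypercubeDistAt k d x >>= λ H → cubeWalk cube τ H x >>= λ y → return (x , y)) event)
        ≡⟨ 𝔼-cong (uniformPoint k d) (λ x → trans (𝔼-bind (hypercubeDistAt k d x) _ event)
             (𝔼-cong (hypercubeDistAt k d x) (λ H → 𝔼-cubeWalk cube H x))) ⟩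
      𝔼 (uniformPoint k d) (λ x → 𝔼 (hypercubeDistAt k d x) (λ H → 𝔼 (uniform S) (λ R → cubeHits cube R H x)))
        ≡⟨ 𝔼-cong (uniformPoint k d) (λ x → 𝔼-comm (hypercubeDistAt k d x) (uniform S) _) ⟩
      𝔼 (uniformPoint k d) (λ x → 𝔼 (uniform S) (λ R → 𝔼 (hypercubeDistAt k d x) (λ H → cubeHits cube R H x)))
        ≡⟨ 𝔼-comm (uniformPoint k d) (uniform S) _ ⟩
      𝔼 (uniform S) (λ R → 𝔼 (uniformPoint k d) (λ x → 𝔼 (hypercubeDistAt k d x) (λ H → cubeHits cube R H x)))
        ≡⟨ 𝔼-cong (uniform S) (λ R → 𝔼-indep₂ d (λ _ → U) (λ _ → orderedPartner)
             (λ i x p → hits i x (cube (lookup R i) p x))) ⟩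
      𝔼 (uniform S) (λ R → ∏ (λ i → 𝔼 U (λ x → 𝔼 (orderedPartner x) (λ p → hits i x (cube (lookup R i) p x)))))   ∎
      where open ≡-Reasoning

module _ (k d : ℕ) (1≤k : 1 ≤ k) (move : Pt k → Pt k → Pt k) (cube : Bool → Pt k × Pt k → Pt k → Pt k)
  (cube-order : ∀ b x c → cube b (order x c) x ≡ movedIf move b x c)
  (cube-lo : ∀ b x c → toℕ x < toℕ c → cube b (x , c) x ≡ movedIf move b x c)
  (cube-hi : ∀ b x c → toℕ x < toℕ c → cube b (x , c) c ≡ movedIf move b c x)
  where
  open Factorisation k d
  open CoordinateLaws k 1≤k move cube cube-order cube-lo cube-hi

  walk-cube-agree : (τ : ℕ) →
    SameDist k d (dist₁ k d (walk walkStep) τ) (dist₂ k d (cubeWalk cube) τ)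
    × SameDist k d (dist₁ k d (walk walkStep) τ) (dist₃ k d (cubeWalk cube) τ)
  walk-cube-agree τ =
    (λ { (ox , oy) → trans (Pr-walk τ _≟ᵖ_ ox oy walkStep)
           (trans (coordinatewise ox oy walkLaw cubeLaw walkLaw≡cubeLaw) (sym (Pr-cubeWalk τ _≟ᵖ_ ox oy cube))) }) ,
    (λ { (ox , oy) → trans (Pr-walk τ _≟ᵖ_ ox oy walkStep)
           (trans (coordinatewise ox oy walkLaw partnerCubeLaw walkLaw≡partnerCubeLaw)
                  (sym (Pr-partnerCubeWalk τ _≟ᵖ_ ox oy cube))) })
    where
    -- the decision procedure built into SameDist
    _≟ᵖ_ : DecidableEquality (Point k d × Point k d)
    _≟ᵖ_ = ×-≡-dec (Vecₚ.≡-dec _≟ᶠ_) (Vecₚ.≡-dec _≟ᶠ_)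
    coordinatewise : (ox oy : Point k d) (law law′ : Bool → Pt k → Pt k → ℚ) → (∀ b x y → law b x y ≡ law′ b x y) →
                     𝔼 (uniform (subsetsOfSize d τ)) (λ R → ∏ (λ i → law (lookup R i) (lookup ox i) (lookup oy i)))
                     ≡ 𝔼 (uniform (subsetsOfSize d τ)) (λ R → ∏ (λ i → law′ (lookup R i) (lookup ox i) (lookup oy i)))
    coordinatewise ox oy law law′ law≗law′ =
      𝔼-cong (uniform (subsetsOfSize d τ)) (λ R → ∏-cong (λ i → law≗law′ (lookup R i) (lookup ox i) (lookup oy i)))

mainTheorem10 : (k d τ : ℕ) → 1 ≤ k → τ ≤ d →
    (SameDist k d (dist₁ k d (upWalk k d) τ) (dist₂ k d (upCubeWalk k d) τ)
      × SameDist k d (dist₁ k d (upWalk k d) τ) (dist₃ k d (upCubeWalk k d) τ))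
    × (SameDist k d (dist₁ k d (downWalk k d) τ) (dist₂ k d (downCubeWalk k d) τ)
      × SameDist k d (dist₁ k d (downWalk k d) τ) (dist₃ k d (downCubeWalk k d) τ))
mainTheorem10 k d τ 1≤k _ =
  walk-cube-agree k d 1≤k moveUp cubeUp cubeUp-order cubeUp-lo cubeUp-hi τ ,
  walk-cube-agree k d 1≤k moveDown cubeDown cubeDown-order cubeDown-lo cubeDown-hi τ
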